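{- Let $F$ be a $3$-graph with an even number of vertices such that $V(F)$ can be partitioned into pairs $\{w_i,z_i\}$ such that for each such pair there exist vertices $u,v$ with $\{w_i,u,v\}\in F$ and $\{z_i,u,v\}\in F$. Then for every $\mu > 0$ there exists $n_0$ such that for all $n \ge n_0$ there exists a $3$-graph $H$ on $n$ vertices such that: $|H| = \frac18\binom{n}{3} \pm \mu n^3$; $H$ is $(\frac18,\mu)$-dense; every vertex of $H$ lies in at least $(\frac18-\mu)\binom{n}{2}$ edges; and $H$ has no perfect $F$-packing.
   Context: A $3$-graph $H$ is a set of $3$-element subsets (edges) of a vertex set $V(H)$; $|H|$ is its number of edges. For $X_1,X_2,X_3\subseteq V(H)$, $e(X_1,X_2,X_3)$ is the number of $(x_1,x_2,x_3)\in X_1\times X_2\times X_3$ with $\{x_1,x_2,x_3\}\in H$. An $n$-vertex $3$-graph is $(p,\mu)$-dense if $e(X_1,X_2,X_3)\ge p|X_1||X_2||X_3|-\mu n^3$ for all $X_1,X_2,X_3\subseteq V(H)$. A perfect $F$-packing of $H$ is a partition of $V(H)$ into sets each spanning a copy of $F$.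
   Formalization: The parameter μ ranges over the positive rationals. -}

module Defs where

open import Data.Bool using (Bool; true; false; if_then_else_; T)
open import Data.Nat using (ℕ; zero; suc; _+_; _*_; _^_; _<_)
open import Data.Nat.Combinatorics using (_C_)
open import Data.Fin using (Fin)
import Data.Fin as Fin
open import Data.Integer using (+_)
open import Data.Rational using (ℚ; _/_; _≤_; _-_) renaming (_*_ to _*ℚ_; _+_ to _+ℚ_)
import Data.Rational as ℚ
open import Data.Product using (Σ; ∃; _×_; _,_)
open import Relation.Binary.PropositionalEquality using (_≡_)
open import Relation.Nullary using (¬_)

-- A 3-graph on vertex set Fin n: a set of 3-element subsets, represented by
-- its (symmetric) indicator on ordered triples; triples with a repeated vertex
-- are never edges.
record Graph3 (n : ℕ) : Set where
  field
    edge   : Fin n → Fin n → Fin n → Bool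
    sym₁₂  : ∀ a b c → edge a b c ≡ edge b a c
    sym₂₃  : ∀ a b c → edge a b c ≡ edge a c b
    irrefl : ∀ a b → edge a a b ≡ false
open Graph3 public

sumFin : {n : ℕ} → (Fin n → ℕ) → ℕ
sumFin {zero}  f = 0
sumFin {suc n} f = f Fin.zero + sumFin (λ i → f (Fin.suc i))

ind : Bool → ℕ
ind true  = 1
ind false = 0

Subset : ℕ → Set
Subset n = Fin n → Bool

card : {n : ℕ} → Subset n → ℕ
card X = sumFin (λ i → ind (X i))

numEdges : {n : ℕ} → Graph3 n → ℕ
numEdges {n} H =
  sumFin (λ i → sumFin (λ j → sumFin (λ k →
    ind (edge H i j k Data.Bool.∧ (Fin.toℕ i Data.Nat.<ᵇ Fin.toℕ j) Data.Bool.∧ (Fin.toℕ j Data.Nat.<ᵇ Fin.toℕ k)))))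

degree : {n : ℕ} → Graph3 n → Fin n → ℕ
degree H v =
  sumFin (λ u → sumFin (λ w →
    ind (edge H v u w Data.Bool.∧ (Fin.toℕ u Data.Nat.<ᵇ Fin.toℕ w))))

e : {n : ℕ} → Graph3 n → Subset n → Subset n → Subset n → ℕ
e H X₁ X₂ X₃ =
  sumFin (λ x₁ → sumFin (λ x₂ → sumFin (λ x₃ →
    ind (X₁ x₁ Data.Bool.∧ X₂ x₂ Data.Bool.∧ X₃ x₃ Data.Bool.∧ edge H x₁ x₂ x₃))))

ℕ→ℚ : ℕ → ℚ
ℕ→ℚ k = (+ k) / 1

Dense : {n : ℕ} → ℚ → ℚ → Graph3 n → Set
Dense {n} p μ H = ∀ (X₁ X₂ X₃ : Subset n) →
  (p *ℚ ℕ→ℚ (card X₁ * card X₂ * card X₃)) - (μ *ℚ ℕ→ℚ (n ^ 3)) ≤ ℕ→ℚ (e H X₁ X₂ X₃)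

-- perfect F-packing of H: V(H) is partitioned into k sets, the j-th being the
-- image of an embedding φ j of F into H (so it spans a copy of F).
PerfectPacking : {m n : ℕ} → Graph3 m → Graph3 n → Set
PerfectPacking {m} {n} F H =
  Σ ℕ λ k → Σ (Fin k → Fin m → Fin n) λ φ →
    (∀ j j′ a a′ → φ j a ≡ φ j′ a′ → (j ≡ j′ × a ≡ a′)) ×
    (∀ (v : Fin n) → ∃ λ j → ∃ λ a → φ j a ≡ v) ×
    (∀ j a b c → T (edge F a b c) → T (edge H (φ j a) (φ j b) (φ j c)))

-- V(F) partitioned into pairs {w,z} (a fixed-point-free involution σ, pairs {a, σ a})
-- such that each pair has u,v with {w,u,v},{z,u,v} ∈ F
PairCondition : {m : ℕ} → Graph3 m → Set
PairCondition {m} F =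
  Σ (Fin m → Fin m) λ σ →
    (∀ a → σ (σ a) ≡ a) × (∀ a → ¬ (σ a ≡ a)) ×
    (∀ a → ∃ λ u → ∃ λ v → T (edge F a u v) × T (edge F (σ a) u v))

module Submission where

-- Let G be a quasirandom graph of density 1/2: a blow-up of the Sylvester–Hadamard graph, whose ±1
-- adjacency matrix has orthogonal rows, so that Lindsey's lemma bounds all its bilinear forms.
-- Fix a special vertex v and let H consist of the triples through v whose other two vertices are
-- adjacent in G, together with the triples avoiding v that span a triangle in the complement of G.
-- Between any three vertex sets, about 1/8 of the triples are triangles of the complement, which gives
-- the edge count, the density condition and the minimum degree (v itself has the dense link G).
-- In a perfect F-packing, let a be the vertex of F placed on v and u, w vertices with a u w and
-- σ a u w in F: then u w is an edge of G because of the edge through v, and a non-edge of G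
-- because of the edge through σ a ≠ v.

module BooleanCases where
  open import Data.Nat using (ℕ; zero; suc)
  open import Data.Bool using (Bool; true; false; _∧_; T)
  open import Data.Product using (_,_)
  open import Data.Bool.Properties using (T-∧)
  open import Function.Bundles using (Equivalence)

  Bools→ : ℕ → Set → Set
  Bools→ zero    A = A
  Bools→ (suc n) A = Bool → Bools→ n A

  zipWith : ∀ n {A B C : Set} → (A → B → C) → Bools→ n A → Bools→ n B → Bools→ n C
  zipWith zero    _∙_ a b = a ∙ b
  zipWith (suc n) _∙_ f g = λ x → zipWith n _∙_ (f x) (g x)

  all : ∀ n → Bools→ n Bool → Bool
  all zero    b = b
  all (suc n) f = all n (f false) ∧ all n (f true)

  Pointwise : ∀ n {A B : Set} → (A → B → Set) → Bools→ n A → Bools→ n B → Set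
  Pointwise zero    R a b = R a b
  Pointwise (suc n) R f g = ∀ x → Pointwise n R (f x) (g x)

  byCases : ∀ n {A B : Set} {R : A → B → Set} (r? : A → B → Bool) → (∀ {a b} → T (r? a b) → R a b) →
            ∀ f g → T (all n (zipWith n r? f g)) → Pointwise n R f g
  byCases zero    r? sound a b ok = sound ok
  byCases (suc n) r? sound f g ok x with Equivalence.to T-∧ ok | x
  ... | ok₀ , _ | false = byCases n r? sound (f false) (g false) ok₀
  ... | _ , ok₁ | true  = byCases n r? sound (f true) (g true) ok₁

module IntegerSum where
  open import Data.Nat as ℕ using (ℕ; zero; suc)
  import Data.Nat.Properties as ℕP
  open import Data.Fin as Fin using (Fin; _↑ˡ_; _↑ʳ_)
  open import Data.Integer as ℤ using (ℤ; +_; 0ℤ; 1ℤ; -_; _+_; _*_; _-_; _≤_; ∣_∣)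
  import Data.Integer.Properties as ℤP
  open import Data.Bool using (Bool; true; false)
  open import Relation.Binary.PropositionalEquality
  open import Relation.Nullary.Decidable using (⌊_⌋; yes; no)
  open import Defs using (sumFin; ind)

  open import Algebra.Properties.Semiring.Sum ℤP.+-*-semiring public
    using (sum; sum-syntax; sum-cong-≗; sum-replicate-zero; ∑-distrib-+; ∑-comm; *-distribˡ-sum; *-distribʳ-sum)

  ∑-const : ∀ {n} c → sum {n} (λ _ → c) ≡ + n * c
  ∑-const {zero}  c = sym (ℤP.*-zeroˡ c)
  ∑-const {suc n} c = begin
    c + sum {n} (λ _ → c) ≡⟨ cong₂ _+_ (sym (ℤP.*-identityˡ c)) (∑-const {n} c) ⟩
    1ℤ * c + + n * c      ≡⟨ ℤP.*-distribʳ-+ c 1ℤ (+ n) ⟨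
    + suc n * c           ∎
    where open ≡-Reasoning

  ∑-neg : ∀ {n} (f : Fin n → ℤ) → sum (λ i → - f i) ≡ - sum f
  ∑-neg f = begin
    sum (λ i → - f i)      ≡⟨ sum-cong-≗ (λ i → sym (ℤP.-1*i≡-i (f i))) ⟩
    sum (λ i → - 1ℤ * f i) ≡⟨ *-distribˡ-sum (- 1ℤ) f ⟨
    - 1ℤ * sum f           ≡⟨ ℤP.-1*i≡-i (sum f) ⟩
    - sum f                ∎
    where open ≡-Reasoning

  ∑-distrib-minus : ∀ {n} (f g : Fin n → ℤ) → sum (λ i → f i - g i) ≡ sum f - sum g
  ∑-distrib-minus f g = trans (∑-distrib-+ f (λ i → - g i)) (cong (_+_ (sum f)) (∑-neg g))

  ∑-mono-≤ : ∀ {n} {f g : Fin n → ℤ} → (∀ i → f i ≤ g i) → sum f ≤ sum g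
  ∑-mono-≤ {zero}  f≤g = ℤP.≤-refl
  ∑-mono-≤ {suc n} f≤g = ℤP.+-mono-≤ (f≤g Fin.zero) (∑-mono-≤ (λ i → f≤g (Fin.suc i)))

  ∑-nonneg : ∀ {n} {f : Fin n → ℤ} → (∀ i → 0ℤ ≤ f i) → 0ℤ ≤ sum f
  ∑-nonneg {n} {f} 0≤f = subst (_≤ sum f) (sum-replicate-zero n) (∑-mono-≤ 0≤f)

  ∑-splitAt : ∀ m {k} (f : Fin (m ℕ.+ k) → ℤ) →
              sum f ≡ sum (λ i → f (i ↑ˡ k)) + sum (λ j → f (m ↑ʳ j))
  ∑-splitAt zero    f = sym (ℤP.+-identityˡ _)
  ∑-splitAt (suc m) f = trans (cong (_+_ (f Fin.zero)) (∑-splitAt m (λ i → f (Fin.suc i))))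
                              (sym (ℤP.+-assoc (f Fin.zero) _ _))

  ∑-combine : ∀ q d (f : Fin (q ℕ.* d) → ℤ) →
              sum f ≡ sum (λ b → sum (λ x → f (Fin.combine {q} {d} b x)))
  ∑-combine zero    d f = refl
  ∑-combine (suc q) d f = trans (∑-splitAt d f) (cong (_+_ (sum (λ x → f (x ↑ˡ (q ℕ.* d))))) (∑-combine q d (λ j → f (d ↑ʳ j))))

  ∣∑∣≤∑∣∣ : ∀ {n} (f : Fin n → ℤ) → + ∣ sum f ∣ ≤ sum (λ i → + ∣ f i ∣)
  ∣∑∣≤∑∣∣ {zero}  f = ℤP.≤-refl
  ∣∑∣≤∑∣∣ {suc n} f = ℤP.≤-trans (ℤ.+≤+ (ℤP.∣i+j∣≤∣i∣+∣j∣ (f Fin.zero) _))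
                                 (ℤP.+-monoʳ-≤ (+ ∣ f Fin.zero ∣) (∣∑∣≤∑∣∣ (λ i → f (Fin.suc i))))

  ∣∑∣≤ : ∀ {n c} (f : Fin n → ℤ) → (∀ i → ∣ f i ∣ ℕ.≤ c) → ∣ sum f ∣ ℕ.≤ n ℕ.* c
  ∣∑∣≤ {zero}  f _     = ℕ.z≤n
  ∣∑∣≤ {suc n} f ∣f∣≤c = ℕP.≤-trans (ℤP.∣i+j∣≤∣i∣+∣j∣ (f Fin.zero) _)
                                   (ℕP.+-mono-≤ (∣f∣≤c Fin.zero) (∣∑∣≤ (λ i → f (Fin.suc i)) (λ i → ∣f∣≤c (Fin.suc i))))

  +-sumFin : ∀ {n} (f : Fin n → ℕ) → + sumFin f ≡ sum (λ i → + f i)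
  +-sumFin {zero}  f = refl
  +-sumFin {suc n} f = trans (ℤP.pos-+ (f Fin.zero) _) (cong (_+_ (+ f Fin.zero)) (+-sumFin (λ i → f (Fin.suc i))))

  𝕀 : Bool → ℤ
  𝕀 true  = 1ℤ
  𝕀 false = 0ℤ

  +-sumFin-ind : ∀ {n} (f : Fin n → Bool) → + sumFin (λ i → ind (f i)) ≡ sum (λ i → 𝕀 (f i))
  +-sumFin-ind f = trans (+-sumFin (λ i → ind (f i))) (sum-cong-≗ (λ i → +ind≡𝕀 (f i)))
    where
    +ind≡𝕀 : ∀ b → + ind b ≡ 𝕀 b
    +ind≡𝕀 true  = refl
    +ind≡𝕀 false = refl

  ∑-𝕀-≡ : ∀ {n} (u : Fin n) → sum (λ v → 𝕀 ⌊ u Fin.≟ v ⌋) ≡ 1ℤ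
  ∑-𝕀-≡ {suc n} Fin.zero    = cong (_+_ 1ℤ) (sum-replicate-zero n)
  ∑-𝕀-≡ {suc n} (Fin.suc u) = cong (_+_ 0ℤ) (trans (sum-cong-≗ suc≟suc) (∑-𝕀-≡ u))
    where
    suc≟suc : ∀ v → 𝕀 ⌊ Fin.suc u Fin.≟ Fin.suc v ⌋ ≡ 𝕀 ⌊ u Fin.≟ v ⌋
    suc≟suc v with u Fin.≟ v
    ... | yes _ = refl
    ... | no  _ = refl

  ∑² : ∀ {n} → (Fin n → Fin n → ℤ) → ℤ
  ∑² f = sum (λ i → sum (λ j → f i j))

  ∑³ : ∀ {n} → (Fin n → Fin n → Fin n → ℤ) → ℤ
  ∑³ f = sum (λ i → sum (λ j → sum (λ k → f i j k)))

  module _ {n : ℕ} where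
    ∑²-cong : ∀ {f g : Fin n → Fin n → ℤ} → (∀ i j → f i j ≡ g i j) → ∑² f ≡ ∑² g
    ∑²-cong f≡g = sum-cong-≗ (λ i → sum-cong-≗ (f≡g i))

    ∑²-distrib-+ : ∀ (f g : Fin n → Fin n → ℤ) → ∑² (λ i j → f i j + g i j) ≡ ∑² f + ∑² g
    ∑²-distrib-+ f g = trans (sum-cong-≗ (λ i → ∑-distrib-+ (f i) (g i))) (∑-distrib-+ (λ i → sum (f i)) (λ i → sum (g i)))

    ∑²-distrib-minus : ∀ (f g : Fin n → Fin n → ℤ) → ∑² (λ i j → f i j - g i j) ≡ ∑² f - ∑² g
    ∑²-distrib-minus f g = trans (sum-cong-≗ (λ i → ∑-distrib-minus (f i) (g i))) (∑-distrib-minus (λ i → sum (f i)) (λ i → sum (g i)))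

    ∑²-*ˡ : ∀ c (f : Fin n → Fin n → ℤ) → ∑² (λ i j → c * f i j) ≡ c * ∑² f
    ∑²-*ˡ c f = trans (sum-cong-≗ (λ i → sym (*-distribˡ-sum c (f i)))) (sym (*-distribˡ-sum c (λ i → sum (f i))))

    ∑²-mono-≤ : ∀ {f g : Fin n → Fin n → ℤ} → (∀ i j → f i j ≤ g i j) → ∑² f ≤ ∑² g
    ∑²-mono-≤ f≤g = ∑-mono-≤ (λ i → ∑-mono-≤ (f≤g i))

    ∑²-const : ∀ c → ∑² {n} (λ _ _ → c) ≡ + n * (+ n * c)
    ∑²-const c = trans (sum-cong-≗ (λ (_ : Fin n) → ∑-const {n} c)) (∑-const {n} (+ n * c))

    ∑²-product : ∀ (a b : Fin n → ℤ) → ∑² (λ i j → a i * b j) ≡ sum a * sum b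
    ∑²-product a b = trans (sum-cong-≗ (λ i → sym (*-distribˡ-sum (a i) b))) (sym (*-distribʳ-sum (sum b) a))

    ∑³-cong : ∀ {f g : Fin n → Fin n → Fin n → ℤ} → (∀ i j k → f i j k ≡ g i j k) → ∑³ f ≡ ∑³ g
    ∑³-cong f≡g = sum-cong-≗ (λ i → ∑²-cong (f≡g i))

    ∑³-distrib-+ : ∀ (f g : Fin n → Fin n → Fin n → ℤ) → ∑³ (λ i j k → f i j k + g i j k) ≡ ∑³ f + ∑³ g
    ∑³-distrib-+ f g = trans (sum-cong-≗ (λ i → ∑²-distrib-+ (f i) (g i))) (∑-distrib-+ (λ i → ∑² (f i)) (λ i → ∑² (g i)))

    ∑³-distrib-minus : ∀ (f g : Fin n → Fin n → Fin n → ℤ) → ∑³ (λ i j k → f i j k - g i j k) ≡ ∑³ f - ∑³ g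
    ∑³-distrib-minus f g = trans (sum-cong-≗ (λ i → ∑²-distrib-minus (f i) (g i))) (∑-distrib-minus (λ i → ∑² (f i)) (λ i → ∑² (g i)))

    ∑³-*ˡ : ∀ c (f : Fin n → Fin n → Fin n → ℤ) → ∑³ (λ i j k → c * f i j k) ≡ c * ∑³ f
    ∑³-*ˡ c f = trans (sum-cong-≗ (λ i → ∑²-*ˡ c (f i))) (sym (*-distribˡ-sum c (λ i → ∑² (f i))))

    ∑³-mono-≤ : ∀ {f g : Fin n → Fin n → Fin n → ℤ} → (∀ i j k → f i j k ≤ g i j k) → ∑³ f ≤ ∑³ g
    ∑³-mono-≤ f≤g = ∑-mono-≤ (λ i → ∑²-mono-≤ (f≤g i))

    ∑³-product : ∀ (a b d : Fin n → ℤ) → ∑³ (λ i j k → a i * b j * d k) ≡ sum a * sum b * sum d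
    ∑³-product a b d = begin
      ∑³ (λ i j k → a i * b j * d k)               ≡⟨ sum-cong-≗ (λ i → sum-cong-≗ (λ j → sym (*-distribˡ-sum (a i * b j) d))) ⟩
      ∑² (λ i j → a i * b j * sum d)               ≡⟨ ∑²-cong (λ i j → ℤP.*-comm (a i * b j) (sum d)) ⟩
      ∑² (λ i j → sum d * (a i * b j))             ≡⟨ ∑²-*ˡ (sum d) (λ i j → a i * b j) ⟩
      sum d * ∑² (λ i j → a i * b j)               ≡⟨ cong (sum d *_) (∑²-product a b) ⟩
      sum d * (sum a * sum b)                       ≡⟨ ℤP.*-comm (sum d) _ ⟩
      sum a * sum b * sum d                         ∎
      where open ≡-Reasoning

    ∑²-ignore₂ : ∀ (g : Fin n → ℤ) → ∑² (λ i j → g i) ≡ + n * sum g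
    ∑²-ignore₂ g = trans (sum-cong-≗ (λ i → ∑-const {n} (g i))) (sym (*-distribˡ-sum (+ n) g))

    ∑²-ignore₁ : ∀ (g : Fin n → ℤ) → ∑² (λ i j → g j) ≡ + n * sum g
    ∑²-ignore₁ g = ∑-const {n} (sum g)

    ∑³-ignore₃ : ∀ (g : Fin n → Fin n → ℤ) → ∑³ (λ i j k → g i j) ≡ + n * ∑² g
    ∑³-ignore₃ g = trans (sum-cong-≗ (λ i → ∑²-ignore₂ (g i))) (sym (*-distribˡ-sum (+ n) (λ i → sum (g i))))

    ∑³-ignore₂ : ∀ (g : Fin n → Fin n → ℤ) → ∑³ (λ i j k → g i k) ≡ + n * ∑² g
    ∑³-ignore₂ g = trans (sum-cong-≗ (λ i → ∑²-ignore₁ (g i))) (sym (*-distribˡ-sum (+ n) (λ i → sum (g i))))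

    ∑³-ignore₁ : ∀ (g : Fin n → Fin n → ℤ) → ∑³ (λ i j k → g j k) ≡ + n * ∑² g
    ∑³-ignore₁ g = ∑-const {n} (∑² g)

    +-sumFin²-ind : ∀ (f : Fin n → Fin n → Bool) →
                    + sumFin (λ i → sumFin (λ j → ind (f i j))) ≡ ∑² (λ i j → 𝕀 (f i j))
    +-sumFin²-ind f = trans (+-sumFin (λ i → sumFin (λ j → ind (f i j)))) (sum-cong-≗ (λ i → +-sumFin-ind (f i)))

    +-sumFin³-ind : ∀ (f : Fin n → Fin n → Fin n → Bool) →
                    + sumFin (λ i → sumFin (λ j → sumFin (λ k → ind (f i j k)))) ≡ ∑³ (λ i j k → 𝕀 (f i j k))
    +-sumFin³-ind f = trans (+-sumFin (λ i → sumFin (λ j → sumFin (λ k → ind (f i j k))))) (sum-cong-≗ (λ i → +-sumFin²-ind (f i)))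

module IntegerBounds where
  open import Data.Nat as ℕ using (ℕ)
  import Data.Nat.Properties as ℕP
  open import Data.Integer as ℤ using (ℤ; +_; -[1+_]; 0ℤ; -_; _+_; _*_; _-_; _≤_; ∣_∣)
  import Data.Integer.Properties as ℤP
  open import Data.Integer.Tactic.RingSolver using (solve-∀)
  open import Data.Product using (_×_; _,_)
  open import Relation.Binary.PropositionalEquality

  ∣i∣*∣i∣≡i*i : ∀ i → + ∣ i ∣ * + ∣ i ∣ ≡ i * i
  ∣i∣*∣i∣≡i*i (+ n)    = refl
  ∣i∣*∣i∣≡i*i -[1+ n ] = refl

  0≤i*i : ∀ i → 0ℤ ≤ i * i
  0≤i*i i = subst (0ℤ ≤_) (trans (ℤP.pos-* ∣ i ∣ ∣ i ∣) (∣i∣*∣i∣≡i*i i)) (ℤ.+≤+ ℕ.z≤n)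

  i*i≤ : ∀ i {c} → ∣ i ∣ ℕ.≤ c → i * i ≤ + c * + c
  i*i≤ i {c} ∣i∣≤c = subst₂ _≤_ (trans (ℤP.pos-* ∣ i ∣ ∣ i ∣) (∣i∣*∣i∣≡i*i i)) (ℤP.pos-* c c)
                            (ℤ.+≤+ (ℕP.*-mono-≤ ∣i∣≤c ∣i∣≤c))

  ≤-by-nonneg : ∀ x y d → y ≡ x + d → 0ℤ ≤ d → x ≤ y
  ≤-by-nonneg x y d y≡x+d 0≤d =
    subst₂ _≤_ (ℤP.+-identityʳ x) (sym y≡x+d) (ℤP.+-monoʳ-≤ x 0≤d)

  am-gm : ∀ l t → + 2 * t * + ∣ l ∣ ≤ l * l + t * t
  am-gm l t = ≤-by-nonneg _ _ (sq (a - t)) identity (0≤i*i (a - t))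
    where
    a = + ∣ l ∣
    sq : ℤ → ℤ
    sq x = x * x
    expand : ∀ a t → a * a + t * t ≡ + 2 * t * a + (a - t) * (a - t)
    expand = solve-∀
    identity : l * l + t * t ≡ + 2 * t * a + sq (a - t)
    identity = trans (cong (_+ t * t) (sym (∣i∣*∣i∣≡i*i l))) (expand a t)

  ∣i+j∣≤ : ∀ i j {a b} → ∣ i ∣ ℕ.≤ a → ∣ j ∣ ℕ.≤ b → ∣ i + j ∣ ℕ.≤ a ℕ.+ b
  ∣i+j∣≤ i j ∣i∣≤a ∣j∣≤b = ℕP.≤-trans (ℤP.∣i+j∣≤∣i∣+∣j∣ i j) (ℕP.+-mono-≤ ∣i∣≤a ∣j∣≤b)

  ∣i*j∣≤ : ∀ i j {a b} → ∣ i ∣ ℕ.≤ a → ∣ j ∣ ℕ.≤ b → ∣ i * j ∣ ℕ.≤ a ℕ.* b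
  ∣i*j∣≤ i j ∣i∣≤a ∣j∣≤b = subst (ℕ._≤ _) (sym (ℤP.abs-* i j)) (ℕP.*-mono-≤ ∣i∣≤a ∣j∣≤b)

  ∣∣≤⇒-≤×≤ : ∀ {i c} → ∣ i ∣ ℕ.≤ c → (- + c ≤ i) × (i ≤ + c)
  ∣∣≤⇒-≤×≤ {+ n}      n≤c = ℤP.≤-trans (ℤP.neg-mono-≤ (ℤ.+≤+ ℕ.z≤n)) (ℤ.+≤+ ℕ.z≤n) , ℤ.+≤+ n≤c
  ∣∣≤⇒-≤×≤ { -[1+ n ]} n<c = ℤP.neg-mono-≤ (ℤ.+≤+ n<c) , ℤP.≤-trans ℤ.-≤+ (ℤ.+≤+ ℕ.z≤n)

  ∣-∣≤⇒ : ∀ {x y K} → ∣ x - y ∣ ℕ.≤ K → (y - + K ≤ x) × (x ≤ y + + K)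
  ∣-∣≤⇒ {x} {y} {K} ∣x-y∣≤K with ∣∣≤⇒-≤×≤ ∣x-y∣≤K
  ... | lower , upper = subst (y - + K ≤_) (y+[x-y]≡x x y) (ℤP.+-monoʳ-≤ y lower)
                      , subst (_≤ y + + K) (y+[x-y]≡x x y) (ℤP.+-monoʳ-≤ y upper)
    where
    y+[x-y]≡x : ∀ x y → y + (x - y) ≡ x
    y+[x-y]≡x = solve-∀

  square-mono-≤ : ∀ {a b} → 0ℤ ≤ a → a ≤ b → a * a ≤ b * b
  square-mono-≤ {a} {b} 0≤a a≤b =
    ℤP.≤-trans (ℤP.*-monoˡ-≤-nonNeg a {{ℤ.nonNegative 0≤a}} a≤b)
               (ℤP.*-monoʳ-≤-nonNeg b {{ℤ.nonNegative (ℤP.≤-trans 0≤a a≤b)}} a≤b)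

  ≤-chain : ∀ {x y z} a b → x - a ≤ y → y - b ≤ z → x ≤ z + (a + b)
  ≤-chain {x} {y} {z} a b x-a≤y y-b≤z = subst₂ _≤_ (cancel x a) (regroup z a b)
    (ℤP.+-monoˡ-≤ a (ℤP.≤-trans x-a≤y (subst (_≤ z + b) (cancel y b) (ℤP.+-monoˡ-≤ b y-b≤z))))
    where
    cancel : ∀ x a → x - a + a ≡ x
    cancel = solve-∀
    regroup : ∀ z a b → z + b + a ≡ z + (a + b)
    regroup = solve-∀

module Sylvester where
  open import Data.Nat as ℕ using (ℕ; zero; suc)
  import Data.Nat.Properties as ℕP
  open import Data.Fin as Fin using (Fin; _↑ˡ_; _↑ʳ_; splitAt)
  open import Data.Fin.Properties using (splitAt-↑ˡ; splitAt-↑ʳ; join-splitAt)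
  open import Data.Integer as ℤ using (ℤ; +_; 0ℤ; 1ℤ; -_; _+_; _*_; _-_; _≤_; ∣_∣)
  import Data.Integer.Properties as ℤP
  open import Data.Integer.Tactic.RingSolver using (solve-∀)
  open import Data.Sum using (_⊎_; inj₁; inj₂)
  open import Data.Bool using (Bool; true; false; not)
  open import Relation.Binary.PropositionalEquality
  open IntegerSum

  -- size k = 2ᵏ, built by doubling so that Fin (size (suc k)) splits as two copies of Fin (size k).
  size : ℕ → ℕ
  size zero    = 1
  size (suc k) = size k ℕ.+ size k

  size-+ : ∀ a b → size (a ℕ.+ b) ≡ size a ℕ.* size b
  size-+ zero    b = sym (ℕP.+-identityʳ (size b))
  size-+ (suc a) b rewrite size-+ a b = sym (ℕP.*-distribʳ-+ (size b) (size a) (size a))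

  size-suc : ∀ k → size k ≡ suc (ℕ.pred (size k))
  size-suc zero = refl
  size-suc (suc k) with size k | size-suc k
  ... | suc _ | _ = refl

  k<size : ∀ k → k ℕ.< size k
  k<size zero    = ℕ.s≤s ℕ.z≤n
  k<size (suc k) = subst (ℕ._< size (suc k)) (ℕP.+-comm k 1) (ℕP.+-mono-<-≤ (k<size k) (ℕP.≤-trans (ℕ.s≤s ℕ.z≤n) (k<size k)))

  origin : ∀ k → Fin (size k)
  origin zero    = Fin.zero
  origin (suc k) = origin k ↑ˡ size k

  -- innerParity k i j is the parity of the inner product of the binary expansions of i and j.
  innerParity : ∀ k → Fin (size k) → Fin (size k) → Bool
  innerParityᵇ : ∀ k → Fin (size k) ⊎ Fin (size k) → Fin (size k) ⊎ Fin (size k) → Bool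
  innerParity zero    _ _ = false
  innerParity (suc k) i j = innerParityᵇ k (splitAt (size k) i) (splitAt (size k) j)
  innerParityᵇ k (inj₁ a) (inj₁ b) = innerParity k a b
  innerParityᵇ k (inj₁ a) (inj₂ b) = innerParity k a b
  innerParityᵇ k (inj₂ a) (inj₁ b) = innerParity k a b
  innerParityᵇ k (inj₂ a) (inj₂ b) = not (innerParity k a b)

  innerParity-sym : ∀ k i j → innerParity k i j ≡ innerParity k j i
  innerParity-sym zero    i j = refl
  innerParity-sym (suc k) i j with splitAt (size k) i | splitAt (size k) j
  ... | inj₁ a | inj₁ b = innerParity-sym k a b
  ... | inj₁ a | inj₂ b = innerParity-sym k a b
  ... | inj₂ a | inj₁ b = innerParity-sym k a b
  ... | inj₂ a | inj₂ b = cong not (innerParity-sym k a b)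

  sgn : Bool → ℤ
  sgn false = 1ℤ
  sgn true  = - 1ℤ

  sgn-not : ∀ b → sgn (not b) ≡ - sgn b
  sgn-not false = refl
  sgn-not true  = refl

  ∣sgn∣≤1 : ∀ b → ∣ sgn b ∣ ℕ.≤ 1
  ∣sgn∣≤1 false = ℕP.≤-refl
  ∣sgn∣≤1 true  = ℕP.≤-refl

  -1≤sgn : ∀ b → - 1ℤ ≤ sgn b
  -1≤sgn false = ℤ.-≤+
  -1≤sgn true  = ℤP.≤-refl

  sylvester : ∀ k → Fin (size k) → Fin (size k) → ℤ
  sylvester k i j = sgn (innerParity k i j)

  walsh : ∀ k → (Fin (size k) → ℤ) → Fin (size k) → ℤ
  walsh k α v = sum (λ u → α u * sylvester k u v)

  module _ (k : ℕ) (α : Fin (size (suc k)) → ℤ) where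
    private
      D = size k
      α₀ α₁ : Fin D → ℤ
      α₀ a = α (a ↑ˡ D)
      α₁ a = α (D ↑ʳ a)

    walsh-↑ˡ : ∀ v → walsh (suc k) α (v ↑ˡ D) ≡ walsh k α₀ v + walsh k α₁ v
    walsh-↑ˡ v = trans (∑-splitAt D _) (cong₂ _+_ (sum-cong-≗ λ a → cong (λ b → α₀ a * sgn b) (parity₀ a))
                                                  (sum-cong-≗ λ a → cong (λ b → α₁ a * sgn b) (parity₁ a)))
      where
      parity₀ : ∀ a → innerParity (suc k) (a ↑ˡ D) (v ↑ˡ D) ≡ innerParity k a v
      parity₀ a rewrite splitAt-↑ˡ D a D | splitAt-↑ˡ D v D = refl
      parity₁ : ∀ a → innerParity (suc k) (D ↑ʳ a) (v ↑ˡ D) ≡ innerParity k a v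
      parity₁ a rewrite splitAt-↑ʳ D D a | splitAt-↑ˡ D v D = refl

    walsh-↑ʳ : ∀ v → walsh (suc k) α (D ↑ʳ v) ≡ walsh k α₀ v - walsh k α₁ v
    walsh-↑ʳ v = trans (∑-splitAt D _) (cong₂ _+_ (sum-cong-≗ λ a → cong (λ b → α₀ a * sgn b) (parity₀ a))
                                                  (trans (sum-cong-≗ negated) (∑-neg (λ a → α₁ a * sylvester k a v))))
      where
      parity₀ : ∀ a → innerParity (suc k) (a ↑ˡ D) (D ↑ʳ v) ≡ innerParity k a v
      parity₀ a rewrite splitAt-↑ˡ D a D | splitAt-↑ʳ D D v = refl
      parity₁ : ∀ a → innerParity (suc k) (D ↑ʳ a) (D ↑ʳ v) ≡ not (innerParity k a v)
      parity₁ a rewrite splitAt-↑ʳ D D a | splitAt-↑ʳ D D v = refl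
      negated : ∀ a → α₁ a * sylvester (suc k) (D ↑ʳ a) (D ↑ʳ v) ≡ - (α₁ a * sylvester k a v)
      negated a rewrite parity₁ a | sgn-not (innerParity k a v) = sym (ℤP.neg-distribʳ-* (α₁ a) _)

  sq : ℤ → ℤ
  sq x = x * x

  walsh-parseval : ∀ k (α : Fin (size k) → ℤ) → sum (λ v → sq (walsh k α v)) ≡ + size k * sum (λ u → sq (α u))
  walsh-parseval zero    α = parseval₁ (α Fin.zero)
    where
    parseval₁ : ∀ a → (a * 1ℤ + 0ℤ) * (a * 1ℤ + 0ℤ) + 0ℤ ≡ + 1 * (a * a + 0ℤ)
    parseval₁ = solve-∀
  walsh-parseval (suc k) α = begin
      sum (λ v → sq (walsh (suc k) α v))
    ≡⟨ ∑-splitAt D _ ⟩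
      sum (λ v → sq (walsh (suc k) α (v ↑ˡ D))) + sum (λ v → sq (walsh (suc k) α (D ↑ʳ v)))
    ≡⟨ cong₂ _+_ (sum-cong-≗ (λ v → cong sq (walsh-↑ˡ k α v))) (sum-cong-≗ (λ v → cong sq (walsh-↑ʳ k α v))) ⟩
      sum (λ v → sq (A v + B v)) + sum (λ v → sq (A v - B v))
    ≡⟨ ∑-distrib-+ (λ v → sq (A v + B v)) (λ v → sq (A v - B v)) ⟨
      sum (λ v → sq (A v + B v) + sq (A v - B v))
    ≡⟨ sum-cong-≗ (λ v → parallelogram (A v) (B v)) ⟩
      sum (λ v → + 2 * (sq (A v) + sq (B v)))
    ≡⟨ *-distribˡ-sum (+ 2) (λ v → sq (A v) + sq (B v)) ⟨
      + 2 * sum (λ v → sq (A v) + sq (B v))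
    ≡⟨ cong (+ 2 *_) (∑-distrib-+ (λ v → sq (A v)) (λ v → sq (B v))) ⟩
      + 2 * (sum (λ v → sq (A v)) + sum (λ v → sq (B v)))
    ≡⟨ cong₂ (λ x y → + 2 * (x + y)) (walsh-parseval k α₀) (walsh-parseval k α₁) ⟩
      + 2 * (+ D * sum (λ u → sq (α₀ u)) + + D * sum (λ u → sq (α₁ u)))
    ≡⟨ regroup (+ D) (sum (λ u → sq (α₀ u))) (sum (λ u → sq (α₁ u))) ⟩
      (+ D + + D) * (sum (λ u → sq (α₀ u)) + sum (λ u → sq (α₁ u)))
    ≡⟨ cong₂ _*_ (ℤP.pos-+ D D) (∑-splitAt D (λ u → sq (α u))) ⟨
      + size (suc k) * sum (λ u → sq (α u)) ∎
    where
    open ≡-Reasoning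
    D = size k
    α₀ α₁ : Fin D → ℤ
    α₀ a = α (a ↑ˡ D)
    α₁ a = α (D ↑ʳ a)
    A = walsh k α₀
    B = walsh k α₁
    parallelogram : ∀ x y → (x + y) * (x + y) + (x - y) * (x - y) ≡ + 2 * (x * x + y * y)
    parallelogram = solve-∀
    regroup : ∀ d a b → + 2 * (d * a + d * b) ≡ (d + d) * (a + b)
    regroup = solve-∀

  walsh-1-nonneg : ∀ k v → 0ℤ ≤ walsh k (λ _ → 1ℤ) v
  walsh-1-nonneg zero    Fin.zero = ℤ.+≤+ ℕ.z≤n
  walsh-1-nonneg (suc k) v = subst (λ w → 0ℤ ≤ walsh (suc k) (λ _ → 1ℤ) w) (join-splitAt (size k) (size k) v)
                                   (nonneg (splitAt (size k) v))
    where
    W = walsh k (λ _ → 1ℤ)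
    nonneg : ∀ x → 0ℤ ≤ walsh (suc k) (λ _ → 1ℤ) (Fin.join (size k) (size k) x)
    nonneg (inj₁ a) = subst (0ℤ ≤_) (sym (walsh-↑ˡ k (λ _ → 1ℤ) a)) (ℤP.+-mono-≤ (walsh-1-nonneg k a) (walsh-1-nonneg k a))
    nonneg (inj₂ a) = ℤP.≤-reflexive (sym (trans (walsh-↑ʳ k (λ _ → 1ℤ) a) (ℤP.+-inverseʳ (W a))))

module Lindsey where
  open import Data.Nat as ℕ using (ℕ; suc)
  import Data.Nat.Properties as ℕP
  open import Data.Fin using (Fin)
  open import Data.Integer as ℤ using (ℤ; +_; _+_; _*_; _≤_; ∣_∣)
  import Data.Integer.Properties as ℤP
  open import Data.Integer.Tactic.RingSolver using (solve-∀)
  open import Relation.Binary.PropositionalEquality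
  open IntegerSum
  open IntegerBounds

  -- Lindsey's lemma, for a matrix of order D = R² with orthogonal rows of squared length D.
  module _ (D r : ℕ) (D≡R² : D ≡ suc r ℕ.* suc r) (S : Fin D → Fin D → ℤ)
    (parseval : ∀ (α : Fin D → ℤ) →
       sum (λ v → sum (λ u → α u * S u v) * sum (λ u → α u * S u v)) ≡ + D * sum (λ u → α u * α u)) where

    private
      R = suc r

      transform : (Fin D → ℤ) → Fin D → ℤ
      transform α v = sum (λ u → α u * S u v)

      bilinear≡ : ∀ (A B : Fin D → ℤ) →
                  sum (λ x → sum (λ y → A x * B y * S x y)) ≡ sum (λ y → B y * transform A y)
      bilinear≡ A B = begin
          sum (λ x → sum (λ y → A x * B y * S x y))
        ≡⟨ ∑-comm (λ x y → A x * B y * S x y) ⟩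
          sum (λ y → sum (λ x → A x * B y * S x y))
        ≡⟨ sum-cong-≗ (λ y → sum-cong-≗ (λ x → swap (A x) (B y) (S x y))) ⟩
          sum (λ y → sum (λ x → B y * (A x * S x y)))
        ≡⟨ sum-cong-≗ (λ y → *-distribˡ-sum (B y) (λ x → A x * S x y)) ⟨
          sum (λ y → B y * transform A y) ∎
        where
        open ≡-Reasoning
        swap : ∀ a b s → a * b * s ≡ b * (a * s)
        swap = solve-∀

      -- Cauchy–Schwarz in the form  2T·∑|L| ≤ ∑ L² + D T²  with T = C R, combined with Parseval.
      ∑∣transform∣≤ : ∀ c (A : Fin D → ℤ) → (∀ x → ∣ A x ∣ ℕ.≤ suc c) →
                      sum (λ y → + ∣ transform A y ∣) ≤ + suc c * (+ R * + R * + R)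
      ∑∣transform∣≤ c A ∣A∣≤C = ℤP.*-cancelˡ-≤-pos _ _ (+ 2 * T) (begin
          + 2 * T * (∑[ y < D ] (+ ∣ L y ∣))
        ≡⟨ *-distribˡ-sum (+ 2 * T) (λ y → + ∣ L y ∣) ⟩
          (∑[ y < D ] (+ 2 * T * + ∣ L y ∣))
        ≤⟨ ∑-mono-≤ (λ y → am-gm (L y) T) ⟩
          (∑[ y < D ] (L y * L y + T * T))
        ≡⟨ trans (∑-distrib-+ (λ y → L y * L y) (λ _ → T * T)) (cong₂ _+_ (parseval A) (∑-const {D} (T * T))) ⟩
          + D * sum (λ x → A x * A x) + + D * (T * T)
        ≤⟨ ℤP.+-monoˡ-≤ (+ D * (T * T)) (ℤP.*-monoˡ-≤-nonNeg (+ D) ∑A²≤) ⟩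
          + D * (+ D * (C * C)) + + D * (T * T)
        ≡⟨ cong (λ d → d * (d * (C * C)) + d * (T * T)) (trans (cong +_ D≡R²) (ℤP.pos-* R R)) ⟩
          (+ R * + R) * ((+ R * + R) * (C * C)) + (+ R * + R) * (T * T)
        ≡⟨ collect C (+ R) ⟩
          + 2 * T * (C * (+ R * + R * + R)) ∎)
        where
        open ℤP.≤-Reasoning
        C = + suc c
        T = C * + R
        L = transform A
        ∑A²≤ : sum (λ x → A x * A x) ≤ + D * (C * C)
        ∑A²≤ = subst (_ ≤_) (∑-const {D} (C * C)) (∑-mono-≤ (λ x → i*i≤ (A x) (∣A∣≤C x)))
        collect : ∀ c r → (r * r) * ((r * r) * (c * c)) + (r * r) * ((c * r) * (c * r)) ≡ + 2 * (c * r) * (c * (r * r * r))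
        collect = solve-∀

    lindsey : ∀ c (A B : Fin D → ℤ) → (∀ x → ∣ A x ∣ ℕ.≤ suc c) → (∀ y → ∣ B y ∣ ℕ.≤ suc c) →
              ∣ sum (λ x → sum (λ y → A x * B y * S x y)) ∣ ℕ.≤ suc c ℕ.* (suc c ℕ.* (R ℕ.* R ℕ.* R))
    lindsey c A B ∣A∣≤C ∣B∣≤C = ℤP.drop‿+≤+ (begin
        + ∣ sum (λ x → sum (λ y → A x * B y * S x y)) ∣
      ≡⟨ cong (λ s → + ∣ s ∣) (bilinear≡ A B) ⟩
        + ∣ ∑[ y < D ] (B y * transform A y) ∣
      ≤⟨ ∣∑∣≤∑∣∣ (λ y → B y * transform A y) ⟩
        (∑[ y < D ] (+ ∣ B y * transform A y ∣))
      ≤⟨ ∑-mono-≤ (λ y → ℤ.+≤+ (∣i*j∣≤ (B y) (transform A y) (∣B∣≤C y) ℕP.≤-refl)) ⟩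
        (∑[ y < D ] (+ (suc c ℕ.* ∣ transform A y ∣)))
      ≡⟨ sum-cong-≗ (λ y → ℤP.pos-* (suc c) ∣ transform A y ∣) ⟩
        (∑[ y < D ] (+ suc c * + ∣ transform A y ∣))
      ≡⟨ *-distribˡ-sum (+ suc c) (λ y → + ∣ transform A y ∣) ⟨
        + suc c * (∑[ y < D ] (+ ∣ transform A y ∣))
      ≤⟨ ℤP.*-monoˡ-≤-nonNeg (+ suc c) (∑∣transform∣≤ c A ∣A∣≤C) ⟩
        + suc c * (+ suc c * (+ R * + R * + R))
      ≡⟨ sym (ℤ-pos c R) ⟩
        + (suc c ℕ.* (suc c ℕ.* (R ℕ.* R ℕ.* R))) ∎)
      where
      open ℤP.≤-Reasoning
      ℤ-pos : ∀ c r → + (suc c ℕ.* (suc c ℕ.* (r ℕ.* r ℕ.* r))) ≡ + suc c * (+ suc c * (+ r * + r * + r))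
      ℤ-pos c r = trans (ℤP.pos-* (suc c) _) (cong (_*_ (+ suc c)) (trans (ℤP.pos-* (suc c) _)
                    (cong (_*_ (+ suc c)) (trans (ℤP.pos-* (r ℕ.* r) r) (cong (_* + r) (ℤP.pos-* r r))))))

module BlowUp where
  open import Data.Nat as ℕ using (ℕ; suc)
  import Data.Nat.Properties as ℕP
  open import Data.Fin as Fin using (Fin; _↑ˡ_; _↑ʳ_; splitAt)
  open import Data.Fin.Properties using (splitAt-↑ˡ; remQuot-combine)
  open import Data.Integer using (ℤ; +_; 0ℤ; 1ℤ; -_; _+_; _*_; _≤_; ∣_∣)
  import Data.Integer.Properties as ℤP
  open import Data.Product using (proj₂)
  open import Data.Sum using ([_,_]′)
  open import Data.Bool using (Bool)
  open import Relation.Binary.PropositionalEquality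
  open IntegerSum
  open IntegerBounds
  open Sylvester
  open Lindsey

  -- The Sylvester graph of order D = 2^(2j) blown up q times, plus rr extra copies of the vertex origin.
  module BlownUpSylvester (j q′ rr : ℕ) where
    k = j ℕ.+ j
    D = size k
    R = size j
    q = suc q′
    Q = q ℕ.* D
    n = Q ℕ.+ rr

    residue : Fin Q → Fin D
    residue i = proj₂ (Fin.remQuot {q} D i)

    project : Fin n → Fin D
    project i = [ residue , (λ _ → origin k) ]′ (splitAt Q i)

    project-↑ˡ : ∀ i → project (i ↑ˡ rr) ≡ residue i
    project-↑ˡ i rewrite splitAt-↑ˡ Q i rr = refl

    adj : Fin n → Fin n → Bool
    adj u v = innerParity k (project u) (project v)

    adj-sym : ∀ u v → adj u v ≡ adj v u
    adj-sym u v = innerParity-sym k (project u) (project v)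

    D≡R² : D ≡ suc (ℕ.pred R) ℕ.* suc (ℕ.pred R)
    D≡R² = trans (size-+ j j) (cong (λ s → s ℕ.* s) (size-suc j))

    discrepancy : ℕ
    discrepancy = (q ℕ.* 2) ℕ.* ((q ℕ.* 2) ℕ.* (R ℕ.* R ℕ.* R)) ℕ.+ Q ℕ.* (rr ℕ.* 4) ℕ.+ rr ℕ.* (n ℕ.* 4)

    private
      combine : Fin q → Fin D → Fin Q
      combine = Fin.combine {q} {D}

      residue-combine : ∀ b x → residue (combine b x) ≡ x
      residue-combine b x = cong proj₂ (remQuot-combine {q} {D} b x)

      fold : (Fin Q → ℤ) → Fin D → ℤ
      fold α x = sum (λ b → α (combine b x))

      ∑-residue : ∀ (α : Fin Q → ℤ) (f : Fin D → ℤ) → sum (λ i → α i * f (residue i)) ≡ sum (λ x → fold α x * f x)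
      ∑-residue α f = begin
          sum (λ i → α i * f (residue i))
        ≡⟨ ∑-combine q D _ ⟩
          sum (λ b → sum (λ x → α (combine b x) * f (residue (combine b x))))
        ≡⟨ sum-cong-≗ (λ b → sum-cong-≗ (λ x → cong (λ y → α (combine b x) * f y) (residue-combine b x))) ⟩
          sum (λ b → sum (λ x → α (combine b x) * f x))
        ≡⟨ ∑-comm (λ b x → α (combine b x) * f x) ⟩
          sum (λ x → sum (λ b → α (combine b x) * f x))
        ≡⟨ sum-cong-≗ (λ x → *-distribʳ-sum (f x) (λ b → α (combine b x))) ⟨
          sum (λ x → fold α x * f x) ∎
        where open ≡-Reasoning

      ∣fold∣≤ : ∀ (α : Fin Q → ℤ) → (∀ i → ∣ α i ∣ ℕ.≤ 2) → ∀ x → ∣ fold α x ∣ ℕ.≤ q ℕ.* 2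
      ∣fold∣≤ α ∣α∣≤2 x = ∣∑∣≤ (λ b → α (combine b x)) (λ b → ∣α∣≤2 (combine b x))

      blockDiscrepancy : ∀ (α β : Fin Q → ℤ) → (∀ u → ∣ α u ∣ ℕ.≤ 2) → (∀ v → ∣ β v ∣ ℕ.≤ 2) →
        ∣ sum (λ i → sum (λ i′ → α i * β i′ * sylvester k (residue i) (residue i′))) ∣ ℕ.≤ (q ℕ.* 2) ℕ.* ((q ℕ.* 2) ℕ.* (R ℕ.* R ℕ.* R))
      blockDiscrepancy α β ∣α∣≤2 ∣β∣≤2 =
        subst₂ (λ s R → ∣ s ∣ ℕ.≤ (q ℕ.* 2) ℕ.* ((q ℕ.* 2) ℕ.* (R ℕ.* R ℕ.* R))) (sym folded) (sym (size-suc j))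
          (lindsey D (ℕ.pred R) D≡R² (sylvester k) (walsh-parseval k)
                   (suc (q′ ℕ.* 2)) (fold α) (fold β) (∣fold∣≤ α ∣α∣≤2) (∣fold∣≤ β ∣β∣≤2))
        where
        G : Fin D → ℤ
        G x = sum (λ i′ → β i′ * sylvester k x (residue i′))
        G≡ : ∀ x → G x ≡ sum (λ y → fold β y * sylvester k x y)
        G≡ x = ∑-residue β (sylvester k x)
        folded : sum (λ i → sum (λ i′ → α i * β i′ * sylvester k (residue i) (residue i′)))
               ≡ sum (λ x → sum (λ y → fold α x * fold β y * sylvester k x y))
        folded = begin
            sum (λ i → sum (λ i′ → α i * β i′ * sylvester k (residue i) (residue i′)))
          ≡⟨ sum-cong-≗ (λ i → trans (sum-cong-≗ (λ i′ → ℤP.*-assoc (α i) (β i′) (sylvester k (residue i) (residue i′))))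
                                     (sym (*-distribˡ-sum (α i) (λ i′ → β i′ * sylvester k (residue i) (residue i′))))) ⟩
            sum (λ i → α i * G (residue i))
          ≡⟨ ∑-residue α G ⟩
            sum (λ x → fold α x * G x)
          ≡⟨ sum-cong-≗ (λ x → trans (cong (fold α x *_) (G≡ x)) (*-distribˡ-sum (fold α x) (λ y → fold β y * sylvester k x y))) ⟩
            sum (λ x → sum (λ y → fold α x * (fold β y * sylvester k x y)))
          ≡⟨ sum-cong-≗ (λ x → sum-cong-≗ (λ y → sym (ℤP.*-assoc (fold α x) (fold β y) (sylvester k x y)))) ⟩
            sum (λ x → sum (λ y → fold α x * fold β y * sylvester k x y)) ∎
          where open ≡-Reasoning

    -- The rr extra vertices are handled crudely: each of their rows and columns contributes at most 4n.
    bilinearDiscrepancy : ∀ (α β : Fin n → ℤ) → (∀ u → ∣ α u ∣ ℕ.≤ 2) → (∀ v → ∣ β v ∣ ℕ.≤ 2) →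
      ∣ sum (λ u → sum (λ v → α u * β v * sgn (adj u v))) ∣ ℕ.≤ discrepancy
    bilinearDiscrepancy α β ∣α∣≤2 ∣β∣≤2 =
      subst (λ s → ∣ s ∣ ℕ.≤ discrepancy) (sym blocks) (∣i+j∣≤ (T₁ + T₂) T₃ (∣i+j∣≤ T₁ T₂ ∣T₁∣≤ ∣T₂∣≤) ∣T₃∣≤)
      where
      F : Fin n → Fin n → ℤ
      F u v = α u * β v * sgn (adj u v)
      ∣F∣≤4 : ∀ u v → ∣ F u v ∣ ℕ.≤ 4
      ∣F∣≤4 u v = subst (ℕ._≤ 4) (sym (ℤP.abs-* (α u * β v) _))
                    (ℕP.*-mono-≤ (∣i*j∣≤ (α u) (β v) (∣α∣≤2 u) (∣β∣≤2 v)) (∣sgn∣≤1 (adj u v)))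
      T₁ = sum (λ i → sum (λ i′ → F (i ↑ˡ rr) (i′ ↑ˡ rr)))
      T₂ = sum (λ i → sum (λ j → F (i ↑ˡ rr) (Q ↑ʳ j)))
      T₃ = sum (λ j → sum (λ v → F (Q ↑ʳ j) v))
      blocks : sum (λ u → sum (λ v → F u v)) ≡ T₁ + T₂ + T₃
      blocks = trans (∑-splitAt Q (λ u → sum (F u)))
                 (cong (_+ T₃) (trans (sum-cong-≗ (λ i → ∑-splitAt Q (F (i ↑ˡ rr))))
                                      (∑-distrib-+ (λ i → sum (λ i′ → F (i ↑ˡ rr) (i′ ↑ˡ rr)))
                                                   (λ i → sum (λ j → F (i ↑ˡ rr) (Q ↑ʳ j))))))
      ∣T₁∣≤ : ∣ T₁ ∣ ℕ.≤ (q ℕ.* 2) ℕ.* ((q ℕ.* 2) ℕ.* (R ℕ.* R ℕ.* R))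
      ∣T₁∣≤ = subst (λ s → ∣ s ∣ ℕ.≤ _)
                (sum-cong-≗ (λ i → sum-cong-≗ (λ i′ →
                   cong₂ (λ x y → α (i ↑ˡ rr) * β (i′ ↑ˡ rr) * sgn (innerParity k x y)) (sym (project-↑ˡ i)) (sym (project-↑ˡ i′)))))
                (blockDiscrepancy (λ i → α (i ↑ˡ rr)) (λ i → β (i ↑ˡ rr)) (λ i → ∣α∣≤2 (i ↑ˡ rr)) (λ i → ∣β∣≤2 (i ↑ˡ rr)))
      ∣T₂∣≤ : ∣ T₂ ∣ ℕ.≤ Q ℕ.* (rr ℕ.* 4)
      ∣T₂∣≤ = ∣∑∣≤ _ (λ i → ∣∑∣≤ (λ j → F (i ↑ˡ rr) (Q ↑ʳ j)) (λ j → ∣F∣≤4 (i ↑ˡ rr) (Q ↑ʳ j)))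
      ∣T₃∣≤ : ∣ T₃ ∣ ℕ.≤ rr ℕ.* (n ℕ.* 4)
      ∣T₃∣≤ = ∣∑∣≤ _ (λ j → ∣∑∣≤ (F (Q ↑ʳ j)) (∣F∣≤4 (Q ↑ʳ j)))

    rowSum≥ : ∀ x → - (+ rr) ≤ sum (λ u → sgn (adj x u))
    rowSum≥ x = subst (- (+ rr) ≤_) (sym (∑-splitAt Q (λ u → sgn (adj x u))))
                  (subst (_≤ sum (λ i → sgn (adj x (i ↑ˡ rr))) + sum (λ j → sgn (adj x (Q ↑ʳ j))))
                         (ℤP.+-identityˡ (- (+ rr))) (ℤP.+-mono-≤ blocks≥0 extra≥-rr))
      where
      blocks≥0 : 0ℤ ≤ sum (λ i → sgn (adj x (i ↑ˡ rr)))
      blocks≥0 = subst (0ℤ ≤_) (sym copies) (∑-nonneg {q} (λ _ → walsh-1-nonneg k (project x)))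
        where
        copies : sum (λ i → sgn (adj x (i ↑ˡ rr))) ≡ sum (λ (b : Fin q) → walsh k (λ _ → 1ℤ) (project x))
        copies = begin
            sum (λ i → sgn (adj x (i ↑ˡ rr)))
          ≡⟨ sum-cong-≗ (λ i → cong (λ y → sgn (innerParity k (project x) y)) (project-↑ˡ i)) ⟩
            sum (λ i → sgn (innerParity k (project x) (residue i)))
          ≡⟨ ∑-combine q D _ ⟩
            sum (λ b → sum (λ y → sgn (innerParity k (project x) (residue (combine b y)))))
          ≡⟨ sum-cong-≗ (λ b → sum-cong-≗ (λ y → trans (cong (λ z → sgn (innerParity k (project x) z)) (residue-combine b y))
                                                       (trans (cong sgn (innerParity-sym k (project x) y)) (sym (ℤP.*-identityˡ _))))) ⟩
            sum (λ (b : Fin q) → walsh k (λ _ → 1ℤ) (project x)) ∎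
          where open ≡-Reasoning
      extra≥-rr : - (+ rr) ≤ sum (λ j → sgn (adj x (Q ↑ʳ j)))
      extra≥-rr = subst (_≤ sum (λ j → sgn (adj x (Q ↑ʳ j))))
                    (trans (∑-const {rr} (- 1ℤ)) (trans (ℤP.*-comm (+ rr) (- 1ℤ)) (ℤP.-1*i≡-i (+ rr))))
                    (∑-mono-≤ (λ j → -1≤sgn (adj x (Q ↑ʳ j))))

module TriangleCount where
  open import Data.Nat as ℕ using (ℕ)
  import Data.Nat.Properties as ℕP
  open import Data.Fin using (Fin)
  open import Data.Integer using (ℤ; +_; 1ℤ; _+_; _*_; _-_; ∣_∣)
  open import Data.Integer.Tactic.RingSolver using (solve-∀)
  open import Data.Bool using (Bool; true; false)
  open import Relation.Binary.PropositionalEquality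
  open IntegerSum
  open IntegerBounds
  open Sylvester using (sgn)

  -- For a graph whose ±1 adjacency pattern has bilinear discrepancy at most E, the weighted count of
  -- triangles in its complement is close to the count in a random graph of density 1/2.
  module Triangles (n : ℕ) (adj : Fin n → Fin n → Bool) (E : ℕ)
    (discrepancy : ∀ (α β : Fin n → ℤ) → (∀ u → ∣ α u ∣ ℕ.≤ 2) → (∀ v → ∣ β v ∣ ℕ.≤ 2) →
       ∣ ∑² (λ u v → α u * β v * sgn (adj u v)) ∣ ℕ.≤ E) where

    -- twice the indicator of a non-edge
    coWeight : Fin n → Fin n → ℤ
    coWeight u v = 1ℤ + sgn (adj u v)

    ∣coWeight∣≤2 : ∀ u v → ∣ coWeight u v ∣ ℕ.≤ 2
    ∣coWeight∣≤2 u v with adj u v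
    ... | true  = ℕ.z≤n
    ... | false = ℕP.≤-refl

    module _ (a b d : Fin n → ℤ) (∣a∣≤1 : ∀ u → ∣ a u ∣ ℕ.≤ 1) (∣b∣≤1 : ∀ u → ∣ b u ∣ ℕ.≤ 1) (∣d∣≤1 : ∀ u → ∣ d u ∣ ℕ.≤ 1) where

      coTriangles : ℤ
      coTriangles = ∑³ (λ u v w → a u * b v * d w * (coWeight u v * coWeight v w * coWeight u w))

      private
        S : Fin n → Fin n → ℤ
        S u v = sgn (adj u v)

        ∣∣≤2 : ∀ x → ∣ x ∣ ℕ.≤ 1 → ∣ x ∣ ℕ.≤ 2
        ∣∣≤2 _ ∣x∣≤1 = ℕP.≤-trans ∣x∣≤1 (ℕ.s≤s ℕ.z≤n)

        ∣*∣≤2 : ∀ x y → ∣ x ∣ ℕ.≤ 1 → ∣ y ∣ ℕ.≤ 2 → ∣ x * y ∣ ℕ.≤ 2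
        ∣*∣≤2 x y ∣x∣≤1 ∣y∣≤2 = ℕP.≤-trans (∣i*j∣≤ x y ∣x∣≤1 ∣y∣≤2) (ℕP.≤-reflexive (ℕP.+-identityʳ 2))

        -- The three error terms of (1 + S₁)(1 + S₂)(1 + S₃) = 1 + S₂ + S₃(1 + S₂) + S₁(1 + S₂)(1 + S₃);
        -- each is a bilinear form in S once one of the three vertices is fixed.
        error₁ error₂ error₃ : ℤ
        error₁ = ∑³ (λ u v w → a u * b v * d w * S v w)
        error₂ = ∑³ (λ u v w → a u * b v * d w * S u w * coWeight v w)
        error₃ = ∑³ (λ u v w → a u * b v * d w * S u v * coWeight v w * coWeight u w)

        expand : coTriangles ≡ sum a * sum b * sum d + error₁ + error₂ + error₃
        expand = begin
            coTriangles
          ≡⟨ ∑³-cong (λ u v w → distribute (a u) (b v) (d w) (S u v) (S v w) (S u w)) ⟩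
            ∑³ (λ u v w → X₀ u v w + X₁ u v w + X₂ u v w + X₃ u v w)
          ≡⟨ ∑³-distrib-+ (λ u v w → X₀ u v w + X₁ u v w + X₂ u v w) X₃ ⟩
            ∑³ (λ u v w → X₀ u v w + X₁ u v w + X₂ u v w) + error₃
          ≡⟨ cong (_+ error₃) (trans (∑³-distrib-+ (λ u v w → X₀ u v w + X₁ u v w) X₂) (cong (_+ error₂) (∑³-distrib-+ X₀ X₁))) ⟩
            ∑³ X₀ + error₁ + error₂ + error₃
          ≡⟨ cong (λ t → t + error₁ + error₂ + error₃) (∑³-product a b d) ⟩
            sum a * sum b * sum d + error₁ + error₂ + error₃ ∎
          where
          open ≡-Reasoning
          X₀ X₁ X₂ X₃ : Fin n → Fin n → Fin n → ℤ
          X₀ u v w = a u * b v * d w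
          X₁ u v w = a u * b v * d w * S v w
          X₂ u v w = a u * b v * d w * S u w * coWeight v w
          X₃ u v w = a u * b v * d w * S u v * coWeight v w * coWeight u w
          distribute : ∀ a b d s₁ s₂ s₃ → a * b * d * ((1ℤ + s₁) * (1ℤ + s₂) * (1ℤ + s₃)) ≡
            a * b * d + a * b * d * s₂ + a * b * d * s₃ * (1ℤ + s₂) + a * b * d * s₁ * (1ℤ + s₂) * (1ℤ + s₃)
          distribute = solve-∀

        ∣error₁∣≤ : ∣ error₁ ∣ ℕ.≤ n ℕ.* E
        ∣error₁∣≤ = ∣∑∣≤ (λ u → ∑² (λ v w → a u * b v * d w * S v w)) (λ u → discrepancy (λ v → a u * b v) d
                      (λ v → ∣∣≤2 (a u * b v) (∣i*j∣≤ (a u) (b v) (∣a∣≤1 u) (∣b∣≤1 v))) (λ w → ∣∣≤2 (d w) (∣d∣≤1 w)))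

        ∣error₂∣≤ : ∣ error₂ ∣ ℕ.≤ n ℕ.* E
        ∣error₂∣≤ = subst (λ t → ∣ t ∣ ℕ.≤ n ℕ.* E) (sym regroup)
                      (∣∑∣≤ _ (λ v → discrepancy a (λ w → b v * d w * coWeight v w) (λ u → ∣∣≤2 (a u) (∣a∣≤1 u))
                        (λ w → ∣*∣≤2 (b v * d w) (coWeight v w) (∣i*j∣≤ (b v) (d w) (∣b∣≤1 v) (∣d∣≤1 w)) (∣coWeight∣≤2 v w))))
          where
          shuffle : ∀ a b d s f → a * b * d * s * f ≡ a * (b * d * f) * s
          shuffle = solve-∀
          regroup : error₂ ≡ sum (λ v → ∑² (λ u w → a u * (b v * d w * coWeight v w) * S u w))
          regroup = trans (∑-comm (λ u v → sum (λ w → a u * b v * d w * S u w * coWeight v w)))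
                          (sum-cong-≗ (λ v → ∑²-cong (λ u w → shuffle (a u) (b v) (d w) (S u w) (coWeight v w))))

        ∣error₃∣≤ : ∣ error₃ ∣ ℕ.≤ n ℕ.* E
        ∣error₃∣≤ = subst (λ t → ∣ t ∣ ℕ.≤ n ℕ.* E) (sym regroup)
                      (∣∑∣≤ _ (λ w → discrepancy (λ u → a u * d w * coWeight u w) (λ v → b v * coWeight v w)
                        (λ u → ∣*∣≤2 (a u * d w) (coWeight u w) (∣i*j∣≤ (a u) (d w) (∣a∣≤1 u) (∣d∣≤1 w)) (∣coWeight∣≤2 u w))
                        (λ v → ∣*∣≤2 (b v) (coWeight v w) (∣b∣≤1 v) (∣coWeight∣≤2 v w))))
          where
          shuffle : ∀ a b d s f₂ f₃ → a * b * d * s * f₂ * f₃ ≡ a * d * f₃ * (b * f₂) * s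
          shuffle = solve-∀
          regroup : error₃ ≡ sum (λ w → ∑² (λ u v → a u * d w * coWeight u w * (b v * coWeight v w) * S u v))
          regroup = trans (sum-cong-≗ (λ u → ∑-comm (λ v w → a u * b v * d w * S u v * coWeight v w * coWeight u w)))
                      (trans (∑-comm (λ u w → sum (λ v → a u * b v * d w * S u v * coWeight v w * coWeight u w)))
                        (sum-cong-≗ (λ w → ∑²-cong (λ u v → shuffle (a u) (b v) (d w) (S u v) (coWeight v w) (coWeight u w)))))

      coTriangles≈ : ∣ coTriangles - sum a * sum b * sum d ∣ ℕ.≤ n ℕ.* E ℕ.+ n ℕ.* E ℕ.+ n ℕ.* E
      coTriangles≈ = subst (λ t → ∣ t ∣ ℕ.≤ _) (sym difference)
                       (∣i+j∣≤ (error₁ + error₂) error₃ (∣i+j∣≤ error₁ error₂ ∣error₁∣≤ ∣error₂∣≤) ∣error₃∣≤)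
        where
        cancel : ∀ t x y z → t + x + y + z - t ≡ x + y + z
        cancel = solve-∀
        difference : coTriangles - sum a * sum b * sum d ≡ error₁ + error₂ + error₃
        difference = trans (cong (_- sum a * sum b * sum d) expand) (cancel (sum a * sum b * sum d) error₁ error₂ error₃)

module OrderedSums where
  open import Data.Nat as ℕ using (ℕ)
  import Data.Nat.Properties as ℕP
  open import Data.Fin as Fin using (Fin; toℕ)
  import Data.Fin.Properties as FinP
  open import Data.Integer using (ℤ; +_; 0ℤ; 1ℤ; _+_; _*_)
  import Data.Integer.Properties as ℤP
  open import Data.Integer.Tactic.RingSolver using (solve-∀)
  open import Data.Bool using (Bool; true; false; T; _∧_)
  open import Data.Unit using (tt)
  open import Data.Empty using (⊥; ⊥-elim)
  open import Relation.Binary using (tri<; tri≈; tri>)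
  open import Relation.Binary.PropositionalEquality
  open IntegerSum

  _<ᶠ_ : ∀ {n} → Fin n → Fin n → Bool
  u <ᶠ w = toℕ u ℕ.<ᵇ toℕ w

  𝕀-∧ : ∀ a b → 𝕀 (a ∧ b) ≡ 𝕀 a * 𝕀 b
  𝕀-∧ true  b = sym (ℤP.*-identityˡ (𝕀 b))
  𝕀-∧ false b = refl

  private
    <ᵇ-true : ∀ {a b} → a ℕ.< b → (a ℕ.<ᵇ b) ≡ true
    <ᵇ-true a<b with ℕP.<⇒<ᵇ a<b
    ... | t = T⇒≡ t
      where
      T⇒≡ : ∀ {b} → T b → b ≡ true
      T⇒≡ {true} _ = refl

    <ᵇ-false : ∀ {a b} → (a ℕ.< b → ⊥) → (a ℕ.<ᵇ b) ≡ false
    <ᵇ-false {a} {b} a≮b with a ℕ.<ᵇ b in eq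
    ... | false = refl
    ... | true  = ⊥-elim (a≮b (ℕP.<ᵇ⇒< a b (subst T (sym eq) tt)))

    <ᶠ⇒< : ∀ {n} (i j : Fin n) → i <ᶠ j ≡ true → toℕ i ℕ.< toℕ j
    <ᶠ⇒< i j eq = ℕP.<ᵇ⇒< (toℕ i) (toℕ j) (subst T (sym eq) tt)

    data Order {n} (u w : Fin n) : Set where
      less    : u <ᶠ w ≡ true  → w <ᶠ u ≡ false → Order u w
      equal   : u ≡ w → Order u w
      greater : u <ᶠ w ≡ false → w <ᶠ u ≡ true → Order u w

    compare : ∀ {n} (u w : Fin n) → Order u w
    compare u w with ℕP.<-cmp (toℕ u) (toℕ w)
    ... | tri< u<w _ w≮u = less (<ᵇ-true u<w) (<ᵇ-false w≮u)
    ... | tri≈ _ u≡w _   = equal (FinP.toℕ-injective u≡w)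
    ... | tri> u≮w _ w<u = greater (<ᵇ-false u≮w) (<ᵇ-true w<u)

    <ᶠ-irrefl : ∀ {n} (u : Fin n) → u <ᶠ u ≡ false
    <ᶠ-irrefl u = <ᵇ-false {toℕ u} (ℕP.<-irrefl refl)

    <ᶠ-trans : ∀ {n} (i j k : Fin n) → i <ᶠ j ≡ true → j <ᶠ k ≡ true → i <ᶠ k ≡ true
    <ᶠ-trans i j k i<j j<k = <ᵇ-true (ℕP.<-trans (<ᶠ⇒< i j i<j) (<ᶠ⇒< j k j<k))

    <ᶠ-asym : ∀ {n} (i k : Fin n) → i <ᶠ k ≡ true → k <ᶠ i ≡ false
    <ᶠ-asym i k i<k = <ᵇ-false (ℕP.<-asym (<ᶠ⇒< i k i<k))

  ∑²-symmetric : ∀ {n} (P : Fin n → Fin n → ℤ) → (∀ u w → P u w ≡ P w u) → (∀ u → P u u ≡ 0ℤ) →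
                 ∑² P ≡ + 2 * ∑² (λ u w → P u w * 𝕀 (u <ᶠ w))
  ∑²-symmetric P sym-P diag = begin
      ∑² P
    ≡⟨ ∑²-cong split ⟩
      ∑² (λ u w → P u w * 𝕀 (u <ᶠ w) + P u w * 𝕀 (w <ᶠ u))
    ≡⟨ ∑²-distrib-+ (λ u w → P u w * 𝕀 (u <ᶠ w)) (λ u w → P u w * 𝕀 (w <ᶠ u)) ⟩
      ∑² (λ u w → P u w * 𝕀 (u <ᶠ w)) + ∑² (λ u w → P u w * 𝕀 (w <ᶠ u))
    ≡⟨ cong (_+_ (∑² (λ u w → P u w * 𝕀 (u <ᶠ w))))
            (trans (∑-comm (λ u w → P u w * 𝕀 (w <ᶠ u))) (∑²-cong (λ w u → cong (_* 𝕀 (w <ᶠ u)) (sym-P u w)))) ⟩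
      ∑² (λ u w → P u w * 𝕀 (u <ᶠ w)) + ∑² (λ u w → P u w * 𝕀 (u <ᶠ w))
    ≡⟨ double _ ⟩
      + 2 * ∑² (λ u w → P u w * 𝕀 (u <ᶠ w)) ∎
    where
    open ≡-Reasoning
    double : ∀ x → x + x ≡ + 2 * x
    double = solve-∀
    split : ∀ u w → P u w ≡ P u w * 𝕀 (u <ᶠ w) + P u w * 𝕀 (w <ᶠ u)
    split u w with compare u w
    ... | less    u<w w≮u rewrite u<w | w≮u = first (P u w)
      where first : ∀ p → p ≡ p * 1ℤ + p * 0ℤ
            first = solve-∀
    ... | greater u≮w w<u rewrite u≮w | w<u = second (P u w)
      where second : ∀ p → p ≡ p * 0ℤ + p * 1ℤ
            second = solve-∀
    ... | equal refl rewrite diag u = refl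

  module _ {n} (P : Fin n → Fin n → Fin n → ℤ)
    (sym₁₂ : ∀ i j k → P i j k ≡ P j i k) (sym₂₃ : ∀ i j k → P i j k ≡ P i k j) (diag : ∀ i k → P i i k ≡ 0ℤ) where

    private
      diag₁₃ : ∀ i j → P i j i ≡ 0ℤ
      diag₁₃ i j = trans (sym₂₃ i j i) (diag i j)

      diag₂₃ : ∀ i j → P i j j ≡ 0ℤ
      diag₂₃ i j = trans (sym₁₂ i j j) (diag₁₃ j i)

      increasing : Fin n → Fin n → Fin n → ℤ
      increasing i j k = 𝕀 (i <ᶠ j) * 𝕀 (j <ᶠ k)

      zero-case : ∀ p x y z w → p * 0ℤ ≡ p * 0ℤ * x + p * 0ℤ * y * z + p * 0ℤ * w
      zero-case = solve-∀

      -- Given j < k, a vertex i distinct from j and k lies in exactly one of the three gaps.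
      position : ∀ i j k → P i j k * 𝕀 (j <ᶠ k) ≡
        P i j k * 𝕀 (j <ᶠ k) * 𝕀 (i <ᶠ j) + P i j k * 𝕀 (j <ᶠ k) * 𝕀 (j <ᶠ i) * 𝕀 (i <ᶠ k) + P i j k * 𝕀 (j <ᶠ k) * 𝕀 (k <ᶠ i)
      position i j k with compare j k
      ... | greater j≮k _ rewrite j≮k = zero-case (P i j k) (𝕀 (i <ᶠ j)) (𝕀 (j <ᶠ i)) (𝕀 (i <ᶠ k)) (𝕀 (k <ᶠ i))
      ... | equal refl rewrite <ᶠ-irrefl j = zero-case (P i j j) (𝕀 (i <ᶠ j)) (𝕀 (j <ᶠ i)) (𝕀 (i <ᶠ j)) (𝕀 (j <ᶠ i))
      ... | less j<k _ with compare i j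
      ...   | equal refl rewrite diag i k = refl
      ...   | less i<j j≮i rewrite j<k | i<j | j≮i | <ᶠ-trans i j k i<j j<k | <ᶠ-asym i k (<ᶠ-trans i j k i<j j<k) = below (P i j k)
        where below : ∀ p → p * 1ℤ ≡ p * 1ℤ * 1ℤ + p * 1ℤ * 0ℤ * 1ℤ + p * 1ℤ * 0ℤ
              below = solve-∀
      ...   | greater i≮j j<i with compare i k
      ...     | equal refl rewrite diag₁₃ i j = refl
      ...     | less i<k k≮i rewrite j<k | i≮j | j<i | i<k | k≮i = between (P i j k)
        where between : ∀ p → p * 1ℤ ≡ p * 1ℤ * 0ℤ + p * 1ℤ * 1ℤ * 1ℤ + p * 1ℤ * 0ℤ
              between = solve-∀
      ...     | greater i≮k k<i rewrite j<k | i≮j | j<i | i≮k | k<i = above (P i j k)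
        where above : ∀ p → p * 1ℤ ≡ p * 1ℤ * 0ℤ + p * 1ℤ * 1ℤ * 0ℤ + p * 1ℤ * 1ℤ
              above = solve-∀

      increasing-trans : ∀ i j k → 𝕀 (i <ᶠ j) * 𝕀 (j <ᶠ k) * 𝕀 (i <ᶠ k) ≡ increasing i j k
      increasing-trans i j k with i <ᶠ j in i<j | j <ᶠ k in j<k
      ... | true  | true  rewrite <ᶠ-trans i j k i<j j<k = refl
      ... | true  | false = refl
      ... | false | _     = refl

    ∑³-symmetric : ∑³ P ≡ + 6 * ∑³ (λ i j k → P i j k * increasing i j k)
    ∑³-symmetric = begin
        ∑³ P
      ≡⟨ sum-cong-≗ (λ i → ∑²-symmetric (P i) (sym₂₃ i) (diag₂₃ i)) ⟩
        sum (λ i → + 2 * ∑² (λ j k → P i j k * 𝕀 (j <ᶠ k)))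
      ≡⟨ *-distribˡ-sum (+ 2) (λ i → ∑² (λ j k → P i j k * 𝕀 (j <ᶠ k))) ⟨
        + 2 * ∑³ (λ i j k → P i j k * 𝕀 (j <ᶠ k))
      ≡⟨ cong (+ 2 *_) (trans (∑³-cong position) (trans (∑³-distrib-+ (λ i j k → A i j k + B i j k) C) (cong (_+ ∑³ C) (∑³-distrib-+ A B)))) ⟩
        + 2 * (∑³ A + ∑³ B + ∑³ C)
      ≡⟨ cong (λ t → + 2 * t) (cong₂ _+_ (cong₂ _+_ A≡N B≡N) C≡N) ⟩
        + 2 * (N + N + N)
      ≡⟨ triple N ⟩
        + 6 * N ∎
      where
      open ≡-Reasoning
      N = ∑³ (λ i j k → P i j k * increasing i j k)
      A B C : Fin n → Fin n → Fin n → ℤ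
      A i j k = P i j k * 𝕀 (j <ᶠ k) * 𝕀 (i <ᶠ j)
      B i j k = P i j k * 𝕀 (j <ᶠ k) * 𝕀 (j <ᶠ i) * 𝕀 (i <ᶠ k)
      C i j k = P i j k * 𝕀 (j <ᶠ k) * 𝕀 (k <ᶠ i)
      triple : ∀ x → + 2 * (x + x + x) ≡ + 6 * x
      triple = solve-∀
      A≡N : ∑³ A ≡ N
      A≡N = ∑³-cong (λ i j k → reorder (P i j k) (𝕀 (j <ᶠ k)) (𝕀 (i <ᶠ j)))
        where reorder : ∀ p x y → p * x * y ≡ p * (y * x)
              reorder = solve-∀
      B≡N : ∑³ B ≡ N
      B≡N = trans (∑-comm (λ i j → sum (B i j)))
              (∑³-cong (λ i j k → trans (reorder (P j i k) (𝕀 (i <ᶠ k)) (𝕀 (i <ᶠ j)) (𝕀 (j <ᶠ k)))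
                (trans (cong (λ p → p * (𝕀 (i <ᶠ j) * 𝕀 (j <ᶠ k) * 𝕀 (i <ᶠ k))) (sym₁₂ j i k))
                       (cong (P i j k *_) (increasing-trans i j k)))))
        where reorder : ∀ p x y z → p * x * y * z ≡ p * (y * z * x)
              reorder = solve-∀
      C≡N : ∑³ C ≡ N
      C≡N = trans (∑-comm (λ i j → sum (C i j)))
              (trans (sum-cong-≗ (λ j → ∑-comm (λ i k → C i j k)))
                (∑³-cong (λ i j k → trans (cong (λ p → p * 𝕀 (i <ᶠ j) * 𝕀 (j <ᶠ k)) (trans (sym₁₂ k i j) (sym₂₃ i k j)))
                                          (ℤP.*-assoc (P i j k) _ _))))

module EdgeRule where
  open import Data.Integer using (ℤ; +_; 1ℤ; _+_; _*_; _-_; _≤_; _≤ᵇ_)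
  import Data.Integer.Properties as ℤP
  open import Data.Bool using (Bool; true; false; not; _∧_; if_then_else_; T)
  import Data.Bool as Bool
  open import Data.Empty using (⊥)
  open import Relation.Binary.PropositionalEquality using (_≡_)
  open import Relation.Nullary.Decidable using (⌊_⌋; toWitness)
  open BooleanCases
  open IntegerSum using (𝕀)
  open Sylvester using (sgn)

  -- The edge rule of the construction, in terms of the Boolean atoms of a triple (a, b, c):
  -- eᵢⱼ says two of the vertices coincide, zᵢ that a vertex is the special vertex, hᵢⱼ that two
  -- vertices are adjacent in the link graph.
  edgeRule : (e₁₂ e₂₃ e₁₃ z₁ z₂ z₃ h₁₂ h₂₃ h₁₃ : Bool) → Bool
  edgeRule e₁₂ e₂₃ e₁₃ z₁ z₂ z₃ h₁₂ h₂₃ h₁₃ =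
    if z₁ then not z₂ ∧ not z₃ ∧ ℓ₂₃ else if z₂ then not z₃ ∧ ℓ₁₃ else if z₃ then ℓ₁₂ else coTriangle
    where
    ℓ₁₂ = not e₁₂ ∧ h₁₂
    ℓ₂₃ = not e₂₃ ∧ h₂₃
    ℓ₁₃ = not e₁₃ ∧ h₁₃
    coTriangle = (not e₁₂ ∧ not h₁₂) ∧ (not e₂₃ ∧ not h₂₃) ∧ (not e₁₃ ∧ not h₁₃)

  coWeightᵇ : Bool → ℤ
  coWeightᵇ h = 1ℤ + sgn h

  private
    ≡-byCases : ∀ n (f g : Bools→ n Bool) → T (all n (zipWith n (λ a b → ⌊ a Bool.≟ b ⌋) f g)) → Pointwise n _≡_ f g
    ≡-byCases n = byCases n _ toWitness

    ≤-byCases : ∀ n (f g : Bools→ n ℤ) → T (all n (zipWith n _≤ᵇ_ f g)) → Pointwise n _≤_ f g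
    ≤-byCases n = byCases n _≤ᵇ_ ℤP.≤ᵇ⇒≤

  edgeRule-swap₁₂ : ∀ e₁₂ e₂₃ e₁₃ z₁ z₂ z₃ h₁₂ h₂₃ h₁₃ →
    edgeRule e₁₂ e₂₃ e₁₃ z₁ z₂ z₃ h₁₂ h₂₃ h₁₃ ≡ edgeRule e₁₂ e₁₃ e₂₃ z₂ z₁ z₃ h₁₂ h₁₃ h₂₃
  edgeRule-swap₁₂ = ≡-byCases 9 edgeRule
    (λ e₁₂ e₂₃ e₁₃ z₁ z₂ z₃ h₁₂ h₂₃ h₁₃ → edgeRule e₁₂ e₁₃ e₂₃ z₂ z₁ z₃ h₁₂ h₁₃ h₂₃) _

  edgeRule-swap₂₃ : ∀ e₁₂ e₂₃ e₁₃ z₁ z₂ z₃ h₁₂ h₂₃ h₁₃ →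
    edgeRule e₁₂ e₂₃ e₁₃ z₁ z₂ z₃ h₁₂ h₂₃ h₁₃ ≡ edgeRule e₁₃ e₂₃ e₁₂ z₁ z₃ z₂ h₁₃ h₂₃ h₁₂
  edgeRule-swap₂₃ = ≡-byCases 9 edgeRule
    (λ e₁₂ e₂₃ e₁₃ z₁ z₂ z₃ h₁₂ h₂₃ h₁₃ → edgeRule e₁₃ e₂₃ e₁₂ z₁ z₃ z₂ h₁₃ h₂₃ h₁₂) _

  edgeRule-degenerate : ∀ e z₁ z₃ h₁₂ h → edgeRule true e e z₁ z₁ z₃ h₁₂ h h ≡ false
  edgeRule-degenerate = ≡-byCases 5 (λ e z₁ z₃ h₁₂ h → edgeRule true e e z₁ z₁ z₃ h₁₂ h h) (λ _ _ _ _ _ → false) _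

  coTriangle-lower : ∀ x₁ x₂ x₃ e₁₂ e₂₃ e₁₃ z₁ z₂ z₃ h₁₂ h₂₃ h₁₃ →
    𝕀 x₁ * 𝕀 x₂ * 𝕀 x₃ * (coWeightᵇ h₁₂ * coWeightᵇ h₂₃ * coWeightᵇ h₁₃)
      - + 8 * (𝕀 e₁₂ + 𝕀 e₂₃ + 𝕀 e₁₃ + (𝕀 z₁ + 𝕀 z₂ + 𝕀 z₃))
    ≤ + 8 * 𝕀 (x₁ ∧ x₂ ∧ x₃ ∧ edgeRule e₁₂ e₂₃ e₁₃ z₁ z₂ z₃ h₁₂ h₂₃ h₁₃)
  coTriangle-lower = ≤-byCases 12
    (λ x₁ x₂ x₃ e₁₂ e₂₃ e₁₃ z₁ z₂ z₃ h₁₂ h₂₃ h₁₃ → 𝕀 x₁ * 𝕀 x₂ * 𝕀 x₃ * (coWeightᵇ h₁₂ * coWeightᵇ h₂₃ * coWeightᵇ h₁₃)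
      - + 8 * (𝕀 e₁₂ + 𝕀 e₂₃ + 𝕀 e₁₃ + (𝕀 z₁ + 𝕀 z₂ + 𝕀 z₃)))
    (λ x₁ x₂ x₃ e₁₂ e₂₃ e₁₃ z₁ z₂ z₃ h₁₂ h₂₃ h₁₃ → + 8 * 𝕀 (x₁ ∧ x₂ ∧ x₃ ∧ edgeRule e₁₂ e₂₃ e₁₃ z₁ z₂ z₃ h₁₂ h₂₃ h₁₃)) _

  coTriangle-upper : ∀ e₁₂ e₂₃ e₁₃ z₁ z₂ z₃ h₁₂ h₂₃ h₁₃ →
    + 8 * 𝕀 (edgeRule e₁₂ e₂₃ e₁₃ z₁ z₂ z₃ h₁₂ h₂₃ h₁₃)
    ≤ coWeightᵇ h₁₂ * coWeightᵇ h₂₃ * coWeightᵇ h₁₃ + + 8 * (𝕀 z₁ + 𝕀 z₂ + 𝕀 z₃)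
  coTriangle-upper = ≤-byCases 9
    (λ e₁₂ e₂₃ e₁₃ z₁ z₂ z₃ h₁₂ h₂₃ h₁₃ → + 8 * 𝕀 (edgeRule e₁₂ e₂₃ e₁₃ z₁ z₂ z₃ h₁₂ h₂₃ h₁₃))
    (λ e₁₂ e₂₃ e₁₃ z₁ z₂ z₃ h₁₂ h₂₃ h₁₃ → coWeightᵇ h₁₂ * coWeightᵇ h₂₃ * coWeightᵇ h₁₃ + + 8 * (𝕀 z₁ + 𝕀 z₂ + 𝕀 z₃)) _

  link-lower : ∀ e₁₂ e₂₃ e₁₃ z₂ z₃ h₁₂ h₂₃ h₁₃ →
    1ℤ - sgn h₂₃ - + 2 * (𝕀 e₂₃ + (𝕀 z₂ + 𝕀 z₃)) ≤ + 2 * 𝕀 (edgeRule e₁₂ e₂₃ e₁₃ true z₂ z₃ h₁₂ h₂₃ h₁₃)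
  link-lower = ≤-byCases 8
    (λ e₁₂ e₂₃ e₁₃ z₂ z₃ h₁₂ h₂₃ h₁₃ → 1ℤ - sgn h₂₃ - + 2 * (𝕀 e₂₃ + (𝕀 z₂ + 𝕀 z₃)))
    (λ e₁₂ e₂₃ e₁₃ z₂ z₃ h₁₂ h₂₃ h₁₃ → + 2 * 𝕀 (edgeRule e₁₂ e₂₃ e₁₃ true z₂ z₃ h₁₂ h₂₃ h₁₃)) _

  -- A pair lying in an edge with the special vertex is adjacent in the link graph, so it lies in no
  -- edge avoiding the special vertex.
  link-exclusive : ∀ e₁₂ e₂₃ e₁₃ z₂ z₃ h₁₂ h₂₃ h₁₃ e₁₂′ e₁₃′ h₁₂′ h₁₃′ →
    T (edgeRule e₁₂ e₂₃ e₁₃ true z₂ z₃ h₁₂ h₂₃ h₁₃) → T (edgeRule e₁₂′ e₂₃ e₁₃′ false z₂ z₃ h₁₂′ h₂₃ h₁₃′) → ⊥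
  link-exclusive = byCases 12 {R = λ a b → T a → T b → ⊥} (λ a b → not (a ∧ b)) disjoint
    (λ e₁₂ e₂₃ e₁₃ z₂ z₃ h₁₂ h₂₃ h₁₃ e₁₂′ e₁₃′ h₁₂′ h₁₃′ → edgeRule e₁₂ e₂₃ e₁₃ true z₂ z₃ h₁₂ h₂₃ h₁₃)
    (λ e₁₂ e₂₃ e₁₃ z₂ z₃ h₁₂ h₂₃ h₁₃ e₁₂′ e₁₃′ h₁₂′ h₁₃′ → edgeRule e₁₂′ e₂₃ e₁₃′ false z₂ z₃ h₁₂′ h₂₃ h₁₃′) _
    where
    disjoint : ∀ {a b} → T (not (a ∧ b)) → T a → T b → ⊥
    disjoint {true}  {true}  ()
    disjoint {true}  {false} _ _ ()
    disjoint {false}         _ ()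

module Construction where
  open import Data.Nat as ℕ using (ℕ)
  import Data.Nat.Properties as ℕP
  open import Data.Fin as Fin using (Fin)
  open import Data.Integer as ℤ using (ℤ; +_; 0ℤ; 1ℤ; -_; _+_; _*_; _-_; _≤_; ∣_∣)
  import Data.Integer.Properties as ℤP
  open import Data.Integer.Tactic.RingSolver using (solve-∀)
  open import Data.Bool using (Bool; true; false; _∧_; T)
  open import Data.Product using (_×_; _,_; proj₁; proj₂)
  open import Data.Empty using (⊥-elim)
  open import Relation.Binary.PropositionalEquality
  open import Relation.Nullary using (¬_; Dec; yes; no)
  open import Relation.Nullary.Decidable using (⌊_⌋)
  open import Defs
  open IntegerSum
  open IntegerBounds
  open OrderedSums
  open Sylvester using (sgn)
  open EdgeRule
  open TriangleCount

  module Hypergraph (n : ℕ) (special : Fin n) (adj : Fin n → Fin n → Bool) (adj-sym : ∀ u v → adj u v ≡ adj v u) where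

    infix 4 _≟ᵇ_
    _≟ᵇ_ : Fin n → Fin n → Bool
    u ≟ᵇ v = ⌊ u Fin.≟ v ⌋

    ≟ᵇ-refl : ∀ u → (u ≟ᵇ u) ≡ true
    ≟ᵇ-refl u with u Fin.≟ u
    ... | yes _   = refl
    ... | no  u≢u = ⊥-elim (u≢u refl)

    ≟ᵇ-sym : ∀ u v → (u ≟ᵇ v) ≡ (v ≟ᵇ u)
    ≟ᵇ-sym u v with u Fin.≟ v | v Fin.≟ u
    ... | yes _   | yes _   = refl
    ... | no  _   | no  _   = refl
    ... | yes u≡v | no  v≢u = ⊥-elim (v≢u (sym u≡v))
    ... | no  u≢v | yes v≡u = ⊥-elim (u≢v (sym v≡u))

    isSpecial : Fin n → Bool
    isSpecial u = u ≟ᵇ special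

    isEdge : Fin n → Fin n → Fin n → Bool
    isEdge a b c = edgeRule (a ≟ᵇ b) (b ≟ᵇ c) (a ≟ᵇ c) (isSpecial a) (isSpecial b) (isSpecial c) (adj a b) (adj b c) (adj a c)

    isEdge-sym₁₂ : ∀ a b c → isEdge a b c ≡ isEdge b a c
    isEdge-sym₁₂ a b c = trans (edgeRule-swap₁₂ (a ≟ᵇ b) (b ≟ᵇ c) (a ≟ᵇ c) (isSpecial a) (isSpecial b) (isSpecial c) (adj a b) (adj b c) (adj a c))
      (cong₂ (λ e h → edgeRule e (a ≟ᵇ c) (b ≟ᵇ c) (isSpecial b) (isSpecial a) (isSpecial c) h (adj a c) (adj b c))
             (≟ᵇ-sym a b) (adj-sym a b))
    isEdge-sym₂₃ : ∀ a b c → isEdge a b c ≡ isEdge a c b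
    isEdge-sym₂₃ a b c = trans (edgeRule-swap₂₃ (a ≟ᵇ b) (b ≟ᵇ c) (a ≟ᵇ c) (isSpecial a) (isSpecial b) (isSpecial c) (adj a b) (adj b c) (adj a c))
      (cong₂ (λ e h → edgeRule (a ≟ᵇ c) e (a ≟ᵇ b) (isSpecial a) (isSpecial c) (isSpecial b) (adj a c) h (adj a b))
             (≟ᵇ-sym b c) (adj-sym b c))
    isEdge-degenerate : ∀ a b → isEdge a a b ≡ false
    isEdge-degenerate a b rewrite ≟ᵇ-refl a = edgeRule-degenerate (a ≟ᵇ b) (isSpecial a) (isSpecial b) (adj a a) (adj a b)

    H : Graph3 n
    H = record { edge = isEdge ; sym₁₂ = isEdge-sym₁₂ ; sym₂₃ = isEdge-sym₂₃ ; irrefl = isEdge-degenerate }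

    notSpecial : ∀ p → ¬ p ≡ special → isSpecial p ≡ false
    notSpecial p p≢special with p Fin.≟ special
    ... | yes p≡special = ⊥-elim (p≢special p≡special)
    ... | no  _         = refl

    link-unique : ∀ p u w → T (isEdge special u w) → T (isEdge p u w) → p ≡ special
    link-unique p u w special-edge p-edge = byCases (p Fin.≟ special)
      where
      byCases : Dec (p ≡ special) → p ≡ special
      byCases (yes p≡special) = p≡special
      byCases (no  p≢special) = ⊥-elim (link-exclusive (special ≟ᵇ u) (u ≟ᵇ w) (special ≟ᵇ w) (isSpecial u) (isSpecial w)
                                                (adj special u) (adj u w) (adj special w)
                                                (p ≟ᵇ u) (p ≟ᵇ w) (adj p u) (adj p w)
        (subst (λ z → T (edgeRule (special ≟ᵇ u) (u ≟ᵇ w) (special ≟ᵇ w) z (isSpecial u) (isSpecial w) (adj special u) (adj u w) (adj special w)))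
               (≟ᵇ-refl special) special-edge)
        (subst (λ z → T (edgeRule (p ≟ᵇ u) (u ≟ᵇ w) (p ≟ᵇ w) z (isSpecial u) (isSpecial w) (adj p u) (adj u w) (adj p w)))
               (notSpecial p p≢special) p-edge))

    -- The copy of F covering the special vertex at a would need a second vertex, σ a, there too.
    noPerfectPacking : ∀ {m} (F : Graph3 m) → PairCondition F → ¬ PerfectPacking F H
    noPerfectPacking F (σ , σ-invol , σ-fixfree , twin) (k , φ , φ-injective , φ-covers , φ-edges)
      with φ-covers special
    ... | j , a , φja≡special with twin a
    ...   | u , w , aux∈F , σaux∈F = σ-fixfree a (sym (proj₂ (φ-injective j j a (σ a) (trans φja≡special (sym φjσa≡special)))))
      where
      φjσa≡special : φ j (σ a) ≡ special
      φjσa≡special = link-unique (φ j (σ a)) (φ j u) (φ j w)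
        (subst (λ p → T (isEdge p (φ j u) (φ j w))) φja≡special (φ-edges j a u w aux∈F)) (φ-edges j (σ a) u w σaux∈F)

    +card≡ : ∀ (X : Subset n) → + card X ≡ sum (λ u → 𝕀 (X u))
    +card≡ X = +-sumFin-ind X

    +e≡ : ∀ X₁ X₂ X₃ → + e H X₁ X₂ X₃ ≡ ∑³ (λ u v w → 𝕀 (X₁ u ∧ X₂ v ∧ X₃ w ∧ isEdge u v w))
    +e≡ X₁ X₂ X₃ = +-sumFin³-ind (λ u v w → X₁ u ∧ X₂ v ∧ X₃ w ∧ isEdge u v w)

    ∑³-isEdge : ∑³ (λ u v w → 𝕀 (isEdge u v w)) ≡ + 6 * + numEdges H
    ∑³-isEdge = trans (∑³-symmetric (λ u v w → 𝕀 (isEdge u v w)) (λ u v w → cong 𝕀 (isEdge-sym₁₂ u v w)) (λ u v w → cong 𝕀 (isEdge-sym₂₃ u v w))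
                                      (λ u w → cong 𝕀 (isEdge-degenerate u w)))
                      (cong (+ 6 *_) (sym (trans (+-sumFin³-ind (λ u v w → isEdge u v w ∧ u <ᶠ v ∧ v <ᶠ w))
                                                 (∑³-cong (λ u v w → 𝕀-∧∧ (isEdge u v w) (u <ᶠ v) (v <ᶠ w))))))
      where
      𝕀-∧∧ : ∀ a b c → 𝕀 (a ∧ b ∧ c) ≡ 𝕀 a * (𝕀 b * 𝕀 c)
      𝕀-∧∧ a b c = trans (𝕀-∧ a (b ∧ c)) (cong (𝕀 a *_) (𝕀-∧ b c))

    ∑²-isEdge : ∀ x → ∑² (λ u w → 𝕀 (isEdge x u w)) ≡ + 2 * + degree H x
    ∑²-isEdge x = trans (∑²-symmetric (λ u w → 𝕀 (isEdge x u w)) (λ u w → cong 𝕀 (isEdge-sym₂₃ x u w))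
                                      (λ u → cong 𝕀 (trans (isEdge-sym₁₂ x u u) (trans (isEdge-sym₂₃ u x u) (isEdge-degenerate u x)))))
                        (cong (+ 2 *_) (sym (trans (+-sumFin²-ind (λ u w → isEdge x u w ∧ u <ᶠ w))
                                                   (∑²-cong (λ u w → 𝕀-∧ (isEdge x u w) (u <ᶠ w))))))

    nℤ : ℤ
    nℤ = + n

    private

      ∑-𝕀-isSpecial : sum (λ u → 𝕀 (isSpecial u)) ≡ 1ℤ
      ∑-𝕀-isSpecial = trans (sum-cong-≗ (λ u → cong 𝕀 (≟ᵇ-sym u special))) (∑-𝕀-≡ special)

      ∑²-𝕀-≟ᵇ : ∑² (λ u v → 𝕀 (u ≟ᵇ v)) ≡ nℤ
      ∑²-𝕀-≟ᵇ = trans (sum-cong-≗ (λ (u : Fin n) → ∑-𝕀-≡ u)) (trans (∑-const {n} 1ℤ) (ℤP.*-identityʳ nℤ))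

      ∑²-special₁ : ∑² (λ u v → 𝕀 (isSpecial u)) ≡ nℤ
      ∑²-special₁ = trans (∑²-ignore₂ (λ u → 𝕀 (isSpecial u))) (trans (cong (nℤ *_) ∑-𝕀-isSpecial) (ℤP.*-identityʳ nℤ))

      ∑²-special₂ : ∑² (λ u v → 𝕀 (isSpecial v)) ≡ nℤ
      ∑²-special₂ = trans (∑²-ignore₁ (λ v → 𝕀 (isSpecial v))) (trans (cong (nℤ *_) ∑-𝕀-isSpecial) (ℤP.*-identityʳ nℤ))

      ∑³-distrib-+₃ : ∀ (f g h : Fin n → Fin n → Fin n → ℤ) →
                      ∑³ (λ u v w → f u v w + g u v w + h u v w) ≡ ∑³ f + ∑³ g + ∑³ h
      ∑³-distrib-+₃ f g h = trans (∑³-distrib-+ (λ u v w → f u v w + g u v w) h) (cong (_+ ∑³ h) (∑³-distrib-+ f g))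

      ∑²-distrib-+₃ : ∀ (f g h : Fin n → Fin n → ℤ) →
                      ∑² (λ u w → f u w + g u w + h u w) ≡ ∑² f + ∑² g + ∑² h
      ∑²-distrib-+₃ f g h = trans (∑²-distrib-+ (λ u w → f u w + g u w) h) (cong (_+ ∑² h) (∑²-distrib-+ f g))

    coincide throughSpecial : Fin n → Fin n → Fin n → ℤ
    coincide u v w = 𝕀 (u ≟ᵇ v) + 𝕀 (v ≟ᵇ w) + 𝕀 (u ≟ᵇ w)
    throughSpecial u v w = 𝕀 (isSpecial u) + 𝕀 (isSpecial v) + 𝕀 (isSpecial w)

    ∑³-throughSpecial : ∑³ throughSpecial ≡ + 3 * (nℤ * nℤ)
    ∑³-throughSpecial = begin
        ∑³ throughSpecial
      ≡⟨ ∑³-distrib-+₃ (λ u v w → 𝕀 (isSpecial u)) (λ u v w → 𝕀 (isSpecial v)) (λ u v w → 𝕀 (isSpecial w)) ⟩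
        ∑³ (λ u v w → 𝕀 (isSpecial u)) + ∑³ (λ u v w → 𝕀 (isSpecial v)) + ∑³ (λ u v w → 𝕀 (isSpecial w))
      ≡⟨ cong₂ _+_ (cong₂ _+_ (trans (∑³-ignore₃ (λ u v → 𝕀 (isSpecial u))) (cong (nℤ *_) ∑²-special₁))
                              (trans (∑³-ignore₃ (λ u v → 𝕀 (isSpecial v))) (cong (nℤ *_) ∑²-special₂)))
                   (trans (∑³-ignore₁ (λ v w → 𝕀 (isSpecial w))) (cong (nℤ *_) ∑²-special₂)) ⟩
        nℤ * nℤ + nℤ * nℤ + nℤ * nℤ
      ≡⟨ thrice (nℤ * nℤ) ⟩
        + 3 * (nℤ * nℤ) ∎
      where
      open ≡-Reasoning
      thrice : ∀ x → x + x + x ≡ + 3 * x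
      thrice = solve-∀

    ∑³-coincide : ∑³ coincide ≡ + 3 * (nℤ * nℤ)
    ∑³-coincide = begin
        ∑³ coincide
      ≡⟨ ∑³-distrib-+₃ (λ u v w → 𝕀 (u ≟ᵇ v)) (λ u v w → 𝕀 (v ≟ᵇ w)) (λ u v w → 𝕀 (u ≟ᵇ w)) ⟩
        ∑³ (λ u v w → 𝕀 (u ≟ᵇ v)) + ∑³ (λ u v w → 𝕀 (v ≟ᵇ w)) + ∑³ (λ u v w → 𝕀 (u ≟ᵇ w))
      ≡⟨ cong₂ _+_ (cong₂ _+_ (trans (∑³-ignore₃ (λ u v → 𝕀 (u ≟ᵇ v))) (cong (nℤ *_) ∑²-𝕀-≟ᵇ))
                              (trans (∑³-ignore₁ (λ v w → 𝕀 (v ≟ᵇ w))) (cong (nℤ *_) ∑²-𝕀-≟ᵇ)))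
                   (trans (∑³-ignore₂ (λ u w → 𝕀 (u ≟ᵇ w))) (cong (nℤ *_) ∑²-𝕀-≟ᵇ)) ⟩
        nℤ * nℤ + nℤ * nℤ + nℤ * nℤ
      ≡⟨ thrice (nℤ * nℤ) ⟩
        + 3 * (nℤ * nℤ) ∎
      where
      open ≡-Reasoning
      thrice : ∀ x → x + x + x ≡ + 3 * x
      thrice = solve-∀

    degenerate : Fin n → Fin n → Fin n → ℤ
    degenerate u v w = coincide u v w + throughSpecial u v w

    ∑³-degenerate : ∑³ degenerate ≡ + 6 * (nℤ * nℤ)
    ∑³-degenerate = trans (∑³-distrib-+ coincide throughSpecial)
                          (trans (cong₂ _+_ ∑³-coincide ∑³-throughSpecial) (add (nℤ * nℤ)))
      where
      add : ∀ x → + 3 * x + + 3 * x ≡ + 6 * x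
      add = solve-∀

    private
      ∑²-link-degenerate : ∀ x → ¬ x ≡ special → ∑² (degenerate x) ≡ + 5 * nℤ
      ∑²-link-degenerate x x≢special = begin
          ∑² (degenerate x)
        ≡⟨ ∑²-distrib-+ (coincide x) (throughSpecial x) ⟩
          ∑² (coincide x) + ∑² (throughSpecial x)
        ≡⟨ cong₂ _+_ (∑²-distrib-+₃ (λ u w → 𝕀 (x ≟ᵇ u)) (λ u w → 𝕀 (u ≟ᵇ w)) (λ u w → 𝕀 (x ≟ᵇ w)))
                     (∑²-distrib-+₃ (λ (u w : Fin n) → 𝕀 (isSpecial x)) (λ u w → 𝕀 (isSpecial u)) (λ u w → 𝕀 (isSpecial w))) ⟩
          ∑² (λ u w → 𝕀 (x ≟ᵇ u)) + ∑² (λ u w → 𝕀 (u ≟ᵇ w)) + ∑² (λ u w → 𝕀 (x ≟ᵇ w))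
            + (∑² (λ (u w : Fin n) → 𝕀 (isSpecial x)) + ∑² (λ u w → 𝕀 (isSpecial u)) + ∑² (λ u w → 𝕀 (isSpecial w)))
        ≡⟨ cong₂ _+_ (cong₂ _+_ (cong₂ _+_ (trans (∑²-ignore₂ (λ u → 𝕀 (x ≟ᵇ u))) (cong (nℤ *_) (∑-𝕀-≡ x))) ∑²-𝕀-≟ᵇ)
                                (trans (∑²-ignore₁ (λ w → 𝕀 (x ≟ᵇ w))) (cong (nℤ *_) (∑-𝕀-≡ x))))
                     (cong₂ _+_ (cong₂ _+_ (trans (∑²-cong {n} (λ _ _ → cong 𝕀 (notSpecial x x≢special))) (∑²-const {n} 0ℤ)) ∑²-special₁) ∑²-special₂) ⟩
          nℤ * 1ℤ + nℤ + nℤ * 1ℤ + (nℤ * (nℤ * 0ℤ) + nℤ + nℤ)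
        ≡⟨ collect nℤ ⟩
          + 5 * nℤ ∎
        where
        open ≡-Reasoning
        collect : ∀ n → n * 1ℤ + n + n * 1ℤ + (n * (n * 0ℤ) + n + n) ≡ + 5 * n
        collect = solve-∀

      degenerateLink : Fin n → Fin n → ℤ
      degenerateLink u w = 𝕀 (u ≟ᵇ w) + (𝕀 (isSpecial u) + 𝕀 (isSpecial w))

      ∑²-degenerateLink : ∑² degenerateLink ≡ + 3 * nℤ
      ∑²-degenerateLink =
        trans (∑²-distrib-+ (λ u w → 𝕀 (u ≟ᵇ w)) (λ u w → 𝕀 (isSpecial u) + 𝕀 (isSpecial w)))
              (trans (cong₂ _+_ ∑²-𝕀-≟ᵇ (trans (∑²-distrib-+ (λ u w → 𝕀 (isSpecial u)) (λ u w → 𝕀 (isSpecial w)))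
                                               (cong₂ _+_ ∑²-special₁ ∑²-special₂)))
                     (thrice nℤ))
        where
        thrice : ∀ x → x + (x + x) ≡ + 3 * x
        thrice = solve-∀

    module Estimates (E : ℕ) (discrepancy : ∀ (α β : Fin n → ℤ) → (∀ u → ∣ α u ∣ ℕ.≤ 2) → (∀ v → ∣ β v ∣ ℕ.≤ 2) →
                                    ∣ ∑² (λ u v → α u * β v * sgn (adj u v)) ∣ ℕ.≤ E)
             (rr : ℕ) (rowSum≥ : ∀ x → - (+ rr) ≤ sum (λ u → sgn (adj x u))) where
      open Triangles n adj E discrepancy

      K slack : ℕ
      K = n ℕ.* E ℕ.+ n ℕ.* E ℕ.+ n ℕ.* E
      slack = K ℕ.+ 48 ℕ.* (n ℕ.* n)

      private
        ∣𝕀∣≤1 : ∀ (X : Fin n → Bool) u → ∣ 𝕀 (X u) ∣ ℕ.≤ 1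
        ∣𝕀∣≤1 X u with X u
        ... | true  = ℕP.≤-refl
        ... | false = ℕ.z≤n

        count : (X₁ X₂ X₃ : Fin n → Bool) → ℤ
        count X₁ X₂ X₃ = coTriangles (λ u → 𝕀 (X₁ u)) (λ u → 𝕀 (X₂ u)) (λ u → 𝕀 (X₃ u)) (∣𝕀∣≤1 X₁) (∣𝕀∣≤1 X₂) (∣𝕀∣≤1 X₃)

        count≈ : ∀ X₁ X₂ X₃ → let T = sum (λ u → 𝕀 (X₁ u)) * sum (λ u → 𝕀 (X₂ u)) * sum (λ u → 𝕀 (X₃ u)) in
                 (T - + K ≤ count X₁ X₂ X₃) × (count X₁ X₂ X₃ ≤ T + + K)
        count≈ X₁ X₂ X₃ = ∣-∣≤⇒ (coTriangles≈ _ _ _ (∣𝕀∣≤1 X₁) (∣𝕀∣≤1 X₂) (∣𝕀∣≤1 X₃))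

        count≤edges : ∀ X₁ X₂ X₃ →
          count X₁ X₂ X₃ - + 8 * (+ 6 * (nℤ * nℤ)) ≤ + 8 * ∑³ (λ u v w → 𝕀 (X₁ u ∧ X₂ v ∧ X₃ w ∧ isEdge u v w))
        count≤edges X₁ X₂ X₃ = subst₂ _≤_
          (trans (∑³-distrib-minus _ (λ u v w → + 8 * degenerate u v w))
                 (cong (_-_ (count X₁ X₂ X₃)) (trans (∑³-*ˡ (+ 8) degenerate)
                                                  (cong (+ 8 *_) ∑³-degenerate))))
          (∑³-*ˡ (+ 8) (λ u v w → 𝕀 (X₁ u ∧ X₂ v ∧ X₃ w ∧ isEdge u v w)))
          (∑³-mono-≤ (λ u v w → coTriangle-lower (X₁ u) (X₂ v) (X₃ w) (u ≟ᵇ v) (v ≟ᵇ w) (u ≟ᵇ w)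
                                   (isSpecial u) (isSpecial v) (isSpecial w) (adj u v) (adj v w) (adj u w)))

        all : Fin n → Bool
        all _ = true

        ∑-all : sum (λ u → 𝕀 (all u)) ≡ nℤ
        ∑-all = trans (∑-const {n} 1ℤ) (ℤP.*-identityʳ nℤ)


      density : ∀ X₁ X₂ X₃ → + card X₁ * + card X₂ * + card X₃ ≤ + 8 * + e H X₁ X₂ X₃ + (+ K + + 8 * (+ 6 * (nℤ * nℤ)))
      density X₁ X₂ X₃ = subst₂ (λ l r → l ≤ r + (+ K + + 8 * (+ 6 * (nℤ * nℤ))))
        (sym (cong₂ _*_ (cong₂ _*_ (+card≡ X₁) (+card≡ X₂)) (+card≡ X₃))) (cong (+ 8 *_) (sym (+e≡ X₁ X₂ X₃)))
        (≤-chain (+ K) _ (proj₁ (count≈ X₁ X₂ X₃)) (count≤edges X₁ X₂ X₃))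

      edgesLower : nℤ * nℤ * nℤ ≤ + 48 * + numEdges H + (+ K + + 8 * (+ 6 * (nℤ * nℤ)))
      edgesLower = subst₂ (λ l r → l ≤ r + (+ K + + 8 * (+ 6 * (nℤ * nℤ))))
        (cong₂ _*_ (cong₂ _*_ ∑-all ∑-all) ∑-all) (trans (cong (+ 8 *_) ∑³-isEdge) (scale (+ numEdges H)))
        (≤-chain (+ K) _ (proj₁ (count≈ all all all)) (count≤edges all all all))
        where
        scale : ∀ x → + 8 * (+ 6 * x) ≡ + 48 * x
        scale = solve-∀

      edgesUpper : + 48 * + numEdges H ≤ nℤ * nℤ * nℤ + + K + + 8 * (+ 3 * (nℤ * nℤ))
      edgesUpper = begin
          + 48 * + numEdges H
        ≡⟨ scale (+ numEdges H) ⟨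
          + 8 * (+ 6 * + numEdges H)
        ≡⟨ cong (+ 8 *_) ∑³-isEdge ⟨
          + 8 * ∑³ (λ u v w → 𝕀 (isEdge u v w))
        ≡⟨ ∑³-*ˡ (+ 8) (λ u v w → 𝕀 (isEdge u v w)) ⟨
          ∑³ (λ u v w → + 8 * 𝕀 (isEdge u v w))
        ≤⟨ ∑³-mono-≤ (λ u v w → coTriangle-upper (u ≟ᵇ v) (v ≟ᵇ w) (u ≟ᵇ w) (isSpecial u) (isSpecial v) (isSpecial w)
                                                  (adj u v) (adj v w) (adj u w)) ⟩
          ∑³ (λ u v w → W u v w + + 8 * throughSpecial u v w)
        ≡⟨ ∑³-distrib-+ W (λ u v w → + 8 * throughSpecial u v w) ⟩
          ∑³ W + ∑³ (λ u v w → + 8 * throughSpecial u v w)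
        ≡⟨ cong₂ _+_ (∑³-cong (λ u v w → sym (drop-ones (W u v w)))) (trans (∑³-*ˡ (+ 8) throughSpecial) (cong (+ 8 *_) ∑³-throughSpecial)) ⟩
          count all all all + + 8 * (+ 3 * (nℤ * nℤ))
        ≤⟨ ℤP.+-monoˡ-≤ (+ 8 * (+ 3 * (nℤ * nℤ))) (proj₂ (count≈ all all all)) ⟩
          sum (λ u → 𝕀 (all u)) * sum (λ u → 𝕀 (all u)) * sum (λ u → 𝕀 (all u)) + + K + + 8 * (+ 3 * (nℤ * nℤ))
        ≡⟨ cong (λ s → s * s * s + + K + + 8 * (+ 3 * (nℤ * nℤ))) ∑-all ⟩
          nℤ * nℤ * nℤ + + K + + 8 * (+ 3 * (nℤ * nℤ)) ∎
        where
        open ℤP.≤-Reasoning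
        W : Fin n → Fin n → Fin n → ℤ
        W u v w = coWeight u v * coWeight v w * coWeight u w
        scale : ∀ x → + 8 * (+ 6 * x) ≡ + 48 * x
        scale = solve-∀
        drop-ones : ∀ x → 1ℤ * 1ℤ * 1ℤ * x ≡ x
        drop-ones = solve-∀

      degreeSpecial : nℤ * nℤ - + E - + 2 * (+ 3 * nℤ) ≤ + 4 * + degree H special
      degreeSpecial = begin
          nℤ * nℤ - + E - + 2 * (+ 3 * nℤ)
        ≤⟨ ℤP.+-monoˡ-≤ (- (+ 2 * (+ 3 * nℤ))) (ℤP.+-monoʳ-≤ (nℤ * nℤ) (ℤP.neg-mono-≤ ∑²sgn≤E)) ⟩
          nℤ * nℤ - ∑² (λ u w → sgn (adj u w)) - + 2 * (+ 3 * nℤ)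
        ≡⟨ cong₂ (λ t d → t - ∑² (λ u w → sgn (adj u w)) - + 2 * d) ∑²-1 ∑²-degenerateLink ⟨
          ∑² (λ (u w : Fin n) → 1ℤ) - ∑² (λ u w → sgn (adj u w)) - + 2 * ∑² degenerateLink
        ≡⟨ cong₂ _-_ (∑²-distrib-minus (λ (u w : Fin n) → 1ℤ) (λ u w → sgn (adj u w))) (∑²-*ˡ (+ 2) degenerateLink) ⟨
          ∑² (λ u w → 1ℤ - sgn (adj u w)) - ∑² (λ u w → + 2 * degenerateLink u w)
        ≡⟨ ∑²-distrib-minus (λ u w → 1ℤ - sgn (adj u w)) (λ u w → + 2 * degenerateLink u w) ⟨
          ∑² (λ u w → 1ℤ - sgn (adj u w) - + 2 * degenerateLink u w)
        ≤⟨ ∑²-mono-≤ pointwise ⟩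
          ∑² (λ u w → + 2 * 𝕀 (isEdge special u w))
        ≡⟨ ∑²-*ˡ (+ 2) (λ u w → 𝕀 (isEdge special u w)) ⟩
          + 2 * ∑² (λ u w → 𝕀 (isEdge special u w))
        ≡⟨ trans (cong (+ 2 *_) (∑²-isEdge special)) (scale (+ degree H special)) ⟩
          + 4 * + degree H special ∎
        where
        open ℤP.≤-Reasoning
        scale : ∀ d → + 2 * (+ 2 * d) ≡ + 4 * d
        scale = solve-∀
        drop-ones : ∀ s → 1ℤ * 1ℤ * s ≡ s
        drop-ones = solve-∀
        ∑²-1 : ∑² (λ (u w : Fin n) → 1ℤ) ≡ nℤ * nℤ
        ∑²-1 = trans (∑²-const {n} 1ℤ) (cong (nℤ *_) (ℤP.*-identityʳ nℤ))
        ∑²sgn≤E : ∑² (λ u w → sgn (adj u w)) ≤ + E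
        ∑²sgn≤E = subst (_≤ + E) (∑²-cong (λ u w → drop-ones (sgn (adj u w))))
                    (proj₂ (∣∣≤⇒-≤×≤ (discrepancy (λ _ → 1ℤ) (λ _ → 1ℤ) (λ _ → ℕ.s≤s ℕ.z≤n) (λ _ → ℕ.s≤s ℕ.z≤n))))
        pointwise : ∀ u w → 1ℤ - sgn (adj u w) - + 2 * degenerateLink u w ≤ + 2 * 𝕀 (isEdge special u w)
        pointwise u w = subst (λ z → 1ℤ - sgn (adj u w) - + 2 * degenerateLink u w
                                     ≤ + 2 * 𝕀 (edgeRule (special ≟ᵇ u) (u ≟ᵇ w) (special ≟ᵇ w) z (isSpecial u) (isSpecial w)
                                                          (adj special u) (adj u w) (adj special w)))
                              (sym (≟ᵇ-refl special))
                              (link-lower (special ≟ᵇ u) (u ≟ᵇ w) (special ≟ᵇ w) (isSpecial u) (isSpecial w)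
                                          (adj special u) (adj u w) (adj special w))

      degreeLower : ∀ x → ¬ x ≡ special → rr ℕ.≤ n →
                    (nℤ - + rr) * (nℤ - + rr) - + E - + 8 * (+ 5 * nℤ) ≤ + 16 * + degree H x
      degreeLower x x≢special rr≤n = begin
          (nℤ - + rr) * (nℤ - + rr) - + E - + 8 * (+ 5 * nℤ)
        ≤⟨ ℤP.+-monoˡ-≤ (- (+ 8 * (+ 5 * nℤ))) (ℤP.+-mono-≤ (square-mono-≤ (ℤP.i≤j⇒0≤j-i (ℤ.+≤+ rr≤n)) n-rr≤s) L≥-E) ⟩
          s * s + L - + 8 * (+ 5 * nℤ)
        ≡⟨ cong₂ (λ p d → p + L - + 8 * d) (∑²-product ω ω) (∑²-link-degenerate x x≢special) ⟨
          ∑² (λ u w → ω u * ω w) + L - + 8 * ∑² (degenerate x)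
        ≡⟨ cong₂ _-_ (∑²-distrib-+ (λ u w → ω u * ω w) (λ u w → ω u * ω w * sgn (adj u w))) (∑²-*ˡ (+ 8) (degenerate x)) ⟨
          ∑² (λ u w → ω u * ω w + ω u * ω w * sgn (adj u w)) - ∑² (λ u w → + 8 * degenerate x u w)
        ≡⟨ cong (_- ∑² (λ u w → + 8 * degenerate x u w)) (∑²-cong (λ u w → expand (ω u) (ω w) (sgn (adj u w)))) ⟨
          ∑² (λ u w → 1ℤ * 1ℤ * 1ℤ * (ω u * coWeight u w * ω w)) - ∑² (λ u w → + 8 * degenerate x u w)
        ≡⟨ ∑²-distrib-minus (λ u w → 1ℤ * 1ℤ * 1ℤ * (ω u * coWeight u w * ω w)) (λ u w → + 8 * degenerate x u w) ⟨
          ∑² (λ u w → 1ℤ * 1ℤ * 1ℤ * (ω u * coWeight u w * ω w) - + 8 * degenerate x u w)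
        ≤⟨ ∑²-mono-≤ (λ u w → coTriangle-lower true true true (x ≟ᵇ u) (u ≟ᵇ w) (x ≟ᵇ w) (isSpecial x) (isSpecial u) (isSpecial w)
                                              (adj x u) (adj u w) (adj x w)) ⟩
          ∑² (λ u w → + 8 * 𝕀 (isEdge x u w))
        ≡⟨ ∑²-*ˡ (+ 8) (λ u w → 𝕀 (isEdge x u w)) ⟩
          + 8 * ∑² (λ u w → 𝕀 (isEdge x u w))
        ≡⟨ trans (cong (+ 8 *_) (∑²-isEdge x)) (scale (+ degree H x)) ⟩
          + 16 * + degree H x ∎
        where
        open ℤP.≤-Reasoning
        ω : Fin n → ℤ
        ω = coWeight x
        s L : ℤ
        s = sum ω
        L = ∑² (λ u w → ω u * ω w * sgn (adj u w))
        expand : ∀ a b t → 1ℤ * 1ℤ * 1ℤ * (a * (1ℤ + t) * b) ≡ a * b + a * b * t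
        expand = solve-∀
        scale : ∀ d → + 8 * (+ 2 * d) ≡ + 16 * d
        scale = solve-∀
        n-rr≤s : nℤ - + rr ≤ s
        n-rr≤s = subst (nℤ - + rr ≤_)
                   (sym (trans (∑-distrib-+ (λ _ → 1ℤ) (λ u → sgn (adj x u)))
                               (cong (_+ sum (λ u → sgn (adj x u))) (trans (∑-const {n} 1ℤ) (ℤP.*-identityʳ nℤ)))))
                   (ℤP.+-monoʳ-≤ nℤ (rowSum≥ x))
        L≥-E : - (+ E) ≤ L
        L≥-E = proj₁ (∣∣≤⇒-≤×≤ (discrepancy ω ω (∣coWeight∣≤2 x) (∣coWeight∣≤2 x)))

      private
        +n² : + (n ℕ.* n) ≡ nℤ * nℤ
        +n² = ℤP.pos-* n n

        +n³ : + (n ℕ.* n ℕ.* n) ≡ nℤ * nℤ * nℤ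
        +n³ = trans (ℤP.pos-* (n ℕ.* n) n) (cong (_* nℤ) +n²)

        +c* : ∀ c x → + (c ℕ.* x) ≡ + c * + x
        +c* = ℤP.pos-*

        48≡8*6 : ∀ x → + 48 * x ≡ + 8 * (+ 6 * x)
        48≡8*6 = solve-∀

        +[x+slack] : ∀ c x → + (c ℕ.* x ℕ.+ slack) ≡ + c * + x + (+ K + + 8 * (+ 6 * (nℤ * nℤ)))
        +[x+slack] c x = trans (ℤP.pos-+ (c ℕ.* x) slack)
          (cong₂ _+_ (+c* c x) (trans (ℤP.pos-+ (K) _) (cong (_+_ (+ K)) (trans (+c* 48 (n ℕ.* n)) (trans (cong (+ 48 *_) +n²) (48≡8*6 _))))))

      density′ : ∀ X₁ X₂ X₃ → card X₁ ℕ.* card X₂ ℕ.* card X₃ ℕ.≤ 8 ℕ.* e H X₁ X₂ X₃ ℕ.+ slack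
      density′ X₁ X₂ X₃ = ℤP.drop‿+≤+ (subst₂ _≤_
        (sym (trans (+c* (card X₁ ℕ.* card X₂) (card X₃)) (cong (_* + card X₃) (+c* (card X₁) (card X₂))))) (sym (+[x+slack] 8 (e H X₁ X₂ X₃)))
        (density X₁ X₂ X₃))

      edgesLower′ : n ℕ.* n ℕ.* n ℕ.≤ 48 ℕ.* numEdges H ℕ.+ slack
      edgesLower′ = ℤP.drop‿+≤+ (subst₂ _≤_ (sym +n³) (sym (+[x+slack] 48 (numEdges H))) edgesLower)

      edgesUpper′ : 48 ℕ.* numEdges H ℕ.≤ n ℕ.* n ℕ.* n ℕ.+ K ℕ.+ 24 ℕ.* (n ℕ.* n)
      edgesUpper′ = ℤP.drop‿+≤+ (subst₂ _≤_ (sym (+c* 48 (numEdges H))) (sym +[n³+K+24n²]) edgesUpper)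
        where
        24≡8*3 : ∀ x → + 24 * x ≡ + 8 * (+ 3 * x)
        24≡8*3 = solve-∀
        +[n³+K+24n²] : + (n ℕ.* n ℕ.* n ℕ.+ K ℕ.+ 24 ℕ.* (n ℕ.* n)) ≡ nℤ * nℤ * nℤ + + K + + 8 * (+ 3 * (nℤ * nℤ))
        +[n³+K+24n²] = trans (ℤP.pos-+ (n ℕ.* n ℕ.* n ℕ.+ K) _)
          (cong₂ _+_ (trans (ℤP.pos-+ (n ℕ.* n ℕ.* n) K) (cong (_+ + K) +n³))
                     (trans (+c* 24 (n ℕ.* n)) (trans (cong (+ 24 *_) +n²) (24≡8*3 _))))

      degreeSlack : ℕ
      degreeSlack = 2 ℕ.* rr ℕ.* n ℕ.+ E ℕ.+ 40 ℕ.* n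

      private
        +[16d+degreeSlack] : ∀ d → + (16 ℕ.* d ℕ.+ degreeSlack) ≡ + 16 * + d + (+ 2 * + rr * nℤ + + E + + 8 * (+ 5 * nℤ))
        +[16d+degreeSlack] d = trans (ℤP.pos-+ (16 ℕ.* d) degreeSlack) (cong₂ _+_ (+c* 16 d)
          (trans (ℤP.pos-+ (2 ℕ.* rr ℕ.* n ℕ.+ E) _) (cong₂ _+_
            (trans (ℤP.pos-+ (2 ℕ.* rr ℕ.* n) E) (cong (_+ + E) (trans (+c* (2 ℕ.* rr) n) (cong (_* nℤ) (+c* 2 rr)))))
            (trans (+c* 40 n) (40≡8*5 nℤ)))))
          where
          40≡8*5 : ∀ x → + 40 * x ≡ + 8 * (+ 5 * x)
          40≡8*5 = solve-∀

        +[4d+E+6n] : ∀ d → + (4 ℕ.* d ℕ.+ (E ℕ.+ 6 ℕ.* n)) ≡ + 4 * + d + (+ E + + 2 * (+ 3 * nℤ))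
        +[4d+E+6n] d = trans (ℤP.pos-+ (4 ℕ.* d) _) (cong₂ _+_ (+c* 4 d)
          (trans (ℤP.pos-+ E (6 ℕ.* n)) (cong (_+_ (+ E)) (trans (+c* 6 n) (6≡2*3 nℤ)))))
          where
          6≡2*3 : ∀ x → + 6 * x ≡ + 2 * (+ 3 * x)
          6≡2*3 = solve-∀

        -- (n - rr)² ≥ n² - 2·rr·n
        degreeAway′ : rr ℕ.≤ n → ∀ x → ¬ x ≡ special → n ℕ.* n ℕ.≤ 16 ℕ.* degree H x ℕ.+ degreeSlack
        degreeAway′ rr≤n x x≢special = ℤP.drop‿+≤+ (subst₂ _≤_ (sym +n²) (sym (+[16d+degreeSlack] (degree H x))) (begin
            nℤ * nℤ
          ≤⟨ ≤-by-nonneg _ _ (+ rr * + rr) (expand nℤ (+ rr) (+ E)) (0≤i*i (+ rr)) ⟩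
            (nℤ - + rr) * (nℤ - + rr) - + E - + 8 * (+ 5 * nℤ) + (+ 2 * + rr * nℤ + + E + + 8 * (+ 5 * nℤ))
          ≤⟨ ℤP.+-monoˡ-≤ _ (degreeLower x x≢special rr≤n) ⟩
            + 16 * + degree H x + (+ 2 * + rr * nℤ + + E + + 8 * (+ 5 * nℤ)) ∎))
          where
          open ℤP.≤-Reasoning
          expand : ∀ n r e → (n - r) * (n - r) - e - + 8 * (+ 5 * n) + (+ 2 * r * n + e + + 8 * (+ 5 * n)) ≡ n * n + r * r
          expand = solve-∀

        degreeSpecial′ : n ℕ.* n ℕ.≤ 16 ℕ.* degree H special ℕ.+ degreeSlack
        degreeSpecial′ = ℕP.≤-trans (ℤP.drop‿+≤+ (subst₂ _≤_ (sym +n²) (sym (+[4d+E+6n] (degree H special))) n²≤))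
                                    (ℕP.+-mono-≤ (ℕP.*-monoˡ-≤ (degree H special) (ℕP.m≤m+n 4 12))
                                                 (ℕP.+-mono-≤ (ℕP.m≤n+m E (2 ℕ.* rr ℕ.* n)) (ℕP.*-monoˡ-≤ n (ℕP.m≤m+n 6 34))))
          where
          cancel : ∀ x a b → x - a - b + (a + b) ≡ x
          cancel = solve-∀
          n²≤ : nℤ * nℤ ≤ + 4 * + degree H special + (+ E + + 2 * (+ 3 * nℤ))
          n²≤ = subst (_≤ + 4 * + degree H special + (+ E + + 2 * (+ 3 * nℤ))) (cancel (nℤ * nℤ) (+ E) (+ 2 * (+ 3 * nℤ)))
                      (ℤP.+-monoˡ-≤ (+ E + + 2 * (+ 3 * nℤ)) degreeSpecial)

      degree′ : rr ℕ.≤ n → ∀ x → n ℕ.* n ℕ.≤ 16 ℕ.* degree H x ℕ.+ degreeSlack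
      degree′ rr≤n x = byCases (x Fin.≟ special)
        where
        byCases : Dec (x ≡ special) → n ℕ.* n ℕ.≤ 16 ℕ.* degree H x ℕ.+ degreeSlack
        byCases (yes refl)      = degreeSpecial′
        byCases (no x≢special) = degreeAway′ rr≤n x x≢special

module NatArithmetic where
  open import Data.Nat as ℕ using (ℕ; zero; suc; _+_; _*_; _≤_; z≤n; s≤s)
  open import Data.Nat.Properties
  open import Data.Nat.Combinatorics using (_C_; nCk+nC[k+1]≡[n+1]C[k+1]; nC1≡n)
  open import Data.Nat.Tactic.RingSolver using (solve-∀)
  open import Relation.Binary.PropositionalEquality

  binomial₂ : ∀ n → 2 * (n C 2) + n ≡ n * n
  binomial₂ zero = refl
  binomial₂ (suc n) = begin
      2 * (suc n C 2) + suc n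
    ≡⟨ cong (λ t → 2 * t + suc n) (sym (nCk+nC[k+1]≡[n+1]C[k+1] n 1)) ⟩
      2 * (n C 1 + n C 2) + suc n
    ≡⟨ cong (λ t → 2 * (t + n C 2) + suc n) (nC1≡n n) ⟩
      2 * (n + n C 2) + suc n
    ≡⟨ regroup n (n C 2) ⟩
      (2 * (n C 2) + n) + 2 * n + 1
    ≡⟨ cong (λ t → t + 2 * n + 1) (binomial₂ n) ⟩
      n * n + 2 * n + 1
    ≡⟨ square n ⟩
      suc n * suc n ∎
    where
    open ≡-Reasoning
    regroup : ∀ n c → 2 * (n + c) + suc n ≡ (2 * c + n) + 2 * n + 1
    regroup = solve-∀
    square : ∀ n → n * n + 2 * n + 1 ≡ suc n * suc n
    square = solve-∀

  binomial₃ : ∀ n → 6 * (n C 3) + 3 * (n * n) ≡ n * n * n + 2 * n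
  binomial₃ zero = refl
  binomial₃ (suc n) = begin
      6 * (suc n C 3) + 3 * (suc n * suc n)
    ≡⟨ cong (λ t → 6 * t + 3 * (suc n * suc n)) (sym (nCk+nC[k+1]≡[n+1]C[k+1] n 2)) ⟩
      6 * (n C 2 + n C 3) + 3 * (suc n * suc n)
    ≡⟨ regroup n (n C 2) (n C 3) ⟩
      (6 * (n C 3) + 3 * (n * n)) + 3 * (2 * (n C 2) + n) + 3 * n + 3
    ≡⟨ cong₂ (λ a b → a + 3 * b + 3 * n + 3) (binomial₃ n) (binomial₂ n) ⟩
      (n * n * n + 2 * n) + 3 * (n * n) + 3 * n + 3
    ≡⟨ cube n ⟩
      suc n * suc n * suc n + 2 * suc n ∎
    where
    open ≡-Reasoning
    regroup : ∀ n c2 c3 → 6 * (c2 + c3) + 3 * (suc n * suc n) ≡ (6 * c3 + 3 * (n * n)) + 3 * (2 * c2 + n) + 3 * n + 3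
    regroup = solve-∀
    cube : ∀ n → (n * n * n + 2 * n) + 3 * (n * n) + 3 * n + 3 ≡ suc n * suc n * suc n + 2 * suc n
    cube = solve-∀

  R*discrepancy≤ : ∀ q R D rr n → D ≡ R * R → q * D ≤ n → rr ≤ D →
    R * ((q * 2) * ((q * 2) * (R * R * R)) + (q * D) * (rr * 4) + rr * (n * 4)) ≤ 4 * (n * n) + 8 * (D * R * n)
  R*discrepancy≤ q R D rr n refl qD≤n rr≤D = begin
      R * ((q * 2) * ((q * 2) * (R * R * R)) + (q * (R * R)) * (rr * 4) + rr * (n * 4))
    ≡⟨ distribute q R rr n ⟩
      4 * ((q * (R * R)) * (q * (R * R))) + 4 * (R * (q * (R * R)) * rr) + 4 * (R * rr * n)
    ≤⟨ +-mono-≤ (+-mono-≤ (*-monoʳ-≤ 4 (*-mono-≤ qD≤n qD≤n)) (*-monoʳ-≤ 4 (*-mono-≤ (*-monoʳ-≤ R qD≤n) rr≤D)))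
                (*-monoʳ-≤ 4 (*-monoˡ-≤ n (*-monoʳ-≤ R rr≤D))) ⟩
      4 * (n * n) + 4 * (R * n * (R * R)) + 4 * (R * (R * R) * n)
    ≡⟨ collect R n ⟩
      4 * (n * n) + 8 * (R * R * R * n) ∎
    where
    open ≤-Reasoning
    distribute : ∀ q R rr n → R * ((q * 2) * ((q * 2) * (R * R * R)) + (q * (R * R)) * (rr * 4) + rr * (n * 4)) ≡
                 4 * ((q * (R * R)) * (q * (R * R))) + 4 * (R * (q * (R * R)) * rr) + 4 * (R * rr * n)
    distribute = solve-∀
    collect : ∀ R n → 4 * (n * n) + 4 * (R * n * (R * R)) + 4 * (R * (R * R) * n) ≡ 4 * (n * n) + 8 * (R * R * R * n)
    collect = solve-∀

  -- With R ≥ 3M and n ≥ 2DR + 4R, an error of order R E ≲ n² + D R n is a 1/M fraction of the main terms.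
  module _ (M R D n E : ℕ) .{{_ : ℕ.NonZero R}} (RE≤ : R * E ≤ 4 * (n * n) + 8 * (D * R * n))
           (3M≤R : 3 * M ≤ R) (n-large : 2 * D * R + 4 * R ≤ n) where

    M*slack≤ : M * ((n * E + n * E + n * E) + 48 * (n * n)) ≤ 8 * (n * n * n)
    M*slack≤ = *-cancelˡ-≤ R (begin
        R * (M * ((n * E + n * E + n * E) + 48 * (n * n)))
      ≡⟨ distribute R M n E ⟩
        3 * M * n * (R * E) + 48 * M * R * (n * n)
      ≤⟨ +-monoˡ-≤ (48 * M * R * (n * n)) (*-monoʳ-≤ (3 * M * n) RE≤) ⟩
        3 * M * n * (4 * (n * n) + 8 * (D * R * n)) + 48 * M * R * (n * n)
      ≡⟨ regroup M n D R ⟩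
        12 * M * (n * n * n) + 12 * M * (n * n) * (2 * D * R + 4 * R)
      ≤⟨ +-monoʳ-≤ (12 * M * (n * n * n)) (*-monoʳ-≤ (12 * M * (n * n)) n-large) ⟩
        12 * M * (n * n * n) + 12 * M * (n * n) * n
      ≡⟨ collect M n ⟩
        (3 * M) * (8 * (n * n * n))
      ≤⟨ *-monoˡ-≤ (8 * (n * n * n)) 3M≤R ⟩
        R * (8 * (n * n * n)) ∎)
      where
      open ≤-Reasoning
      distribute : ∀ R M n E → R * (M * ((n * E + n * E + n * E) + 48 * (n * n))) ≡ 3 * M * n * (R * E) + 48 * M * R * (n * n)
      distribute = solve-∀
      regroup : ∀ M n D R → 3 * M * n * (4 * (n * n) + 8 * (D * R * n)) + 48 * M * R * (n * n)
                            ≡ 12 * M * (n * n * n) + 12 * M * (n * n) * (2 * D * R + 4 * R)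
      regroup = solve-∀
      collect : ∀ M n → 12 * M * (n * n * n) + 12 * M * (n * n) * n ≡ (3 * M) * (8 * (n * n * n))
      collect = solve-∀

    M*degreeSlack≤ : ∀ rr c → 1 ≤ M → rr ≤ D → 2 * c + n ≡ n * n → M * (2 * rr * n + E + 40 * n) ≤ 16 * c
    M*degreeSlack≤ rr c 1≤M rr≤D binomial = *-cancelˡ-≤ R (+-cancelʳ-≤ (8 * R * n) _ _ (begin
        R * (M * (2 * rr * n + E + 40 * n)) + 8 * R * n
      ≡⟨ distribute R M rr n E ⟩
        2 * M * R * n * rr + M * (R * E) + 40 * M * R * n + 8 * R * n
      ≤⟨ +-monoˡ-≤ (8 * R * n) (+-monoˡ-≤ (40 * M * R * n) (+-mono-≤ (*-monoʳ-≤ (2 * M * R * n) rr≤D) (*-monoʳ-≤ M RE≤))) ⟩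
        2 * M * R * n * D + M * (4 * (n * n) + 8 * (D * R * n)) + 40 * M * R * n + 8 * R * n
      ≤⟨ +-monoʳ-≤ (2 * M * R * n * D + M * (4 * (n * n) + 8 * (D * R * n)) + 40 * M * R * n)
                   (*-monoʳ-≤ (8 * R) (subst (_≤ M * n) (*-identityˡ n) (*-monoˡ-≤ n 1≤M))) ⟩
        2 * M * R * n * D + M * (4 * (n * n) + 8 * (D * R * n)) + 40 * M * R * n + 8 * R * (M * n)
      ≡⟨ regroup M R n D ⟩
        4 * M * (n * n) + M * n * (10 * D * R + 48 * R)
      ≤⟨ +-monoʳ-≤ (4 * M * (n * n)) (*-monoʳ-≤ (M * n) (subst (10 * D * R + 48 * R ≤_) (pad D R) (m≤m+n _ (30 * D * R + 32 * R)))) ⟩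
        4 * M * (n * n) + M * n * (20 * (2 * D * R + 4 * R))
      ≤⟨ +-monoʳ-≤ (4 * M * (n * n)) (*-monoʳ-≤ (M * n) (*-monoʳ-≤ 20 n-large)) ⟩
        4 * M * (n * n) + M * n * (20 * n)
      ≡⟨ collect M n ⟩
        (3 * M) * (8 * (n * n))
      ≤⟨ *-monoˡ-≤ (8 * (n * n)) 3M≤R ⟩
        R * (8 * (n * n))
      ≡⟨ cong (λ t → R * (8 * t)) (sym binomial) ⟩
        R * (8 * (2 * c + n))
      ≡⟨ split R c n ⟩
        R * (16 * c) + 8 * R * n ∎))
      where
      open ≤-Reasoning
      distribute : ∀ R M rr n E → R * (M * (2 * rr * n + E + 40 * n)) + 8 * R * n
                                  ≡ 2 * M * R * n * rr + M * (R * E) + 40 * M * R * n + 8 * R * n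
      distribute = solve-∀
      regroup : ∀ M R n D → 2 * M * R * n * D + M * (4 * (n * n) + 8 * (D * R * n)) + 40 * M * R * n + 8 * R * (M * n)
                            ≡ 4 * M * (n * n) + M * n * (10 * D * R + 48 * R)
      regroup = solve-∀
      pad : ∀ D R → 10 * D * R + 48 * R + (30 * D * R + 32 * R) ≡ 20 * (2 * D * R + 4 * R)
      pad = solve-∀
      collect : ∀ M n → 4 * M * (n * n) + M * n * (20 * n) ≡ (3 * M) * (8 * (n * n))
      collect = solve-∀
      split : ∀ R c n → R * (8 * (2 * c + n)) ≡ R * (16 * c) + 8 * R * n
      split = solve-∀

  module _ (n N c : ℕ) (binomial : 6 * c + 3 * (n * n) ≡ n * n * n + 2 * n) where
    6c≤n³ : 6 * c ≤ n * n * n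
    6c≤n³ = +-cancelʳ-≤ (3 * (n * n)) (6 * c) (n * n * n) (begin
        6 * c + 3 * (n * n)     ≡⟨ binomial ⟩
        n * n * n + 2 * n       ≤⟨ +-monoʳ-≤ (n * n * n) (*-mono-≤ {2} {3} (s≤s (s≤s z≤n)) (n≤n*n n)) ⟩
        n * n * n + 3 * (n * n) ∎)
      where
      open ≤-Reasoning
      n≤n*n : ∀ n → n ≤ n * n
      n≤n*n zero    = z≤n
      n≤n*n (suc n) = m≤m*n (suc n) (suc n)

    48N≤6c+ : ∀ K → 48 * N ≤ n * n * n + K + 24 * (n * n) → 48 * N ≤ 6 * c + (K + 48 * (n * n))
    48N≤6c+ K 48N≤ = begin
        48 * N                                     ≤⟨ 48N≤ ⟩
        n * n * n + K + 24 * (n * n)               ≤⟨ +-monoˡ-≤ (24 * (n * n)) (+-monoˡ-≤ K (m≤m+n (n * n * n) (2 * n))) ⟩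
        n * n * n + 2 * n + K + 24 * (n * n)       ≡⟨ cong (λ t → t + K + 24 * (n * n)) binomial ⟨
        6 * c + 3 * (n * n) + K + 24 * (n * n)     ≡⟨ regroup (6 * c) K (n * n) ⟩
        6 * c + (K + 27 * (n * n))                 ≤⟨ +-monoʳ-≤ (6 * c) (+-monoʳ-≤ K (*-monoˡ-≤ (n * n) (m≤m+n 27 21))) ⟩
        6 * c + (K + 48 * (n * n))                 ∎
      where
      open ≤-Reasoning
      regroup : ∀ c k s → c + 3 * s + k + 24 * s ≡ c + (k + 27 * s)
      regroup = solve-∀

    6c≤48N+ : ∀ S → n * n * n ≤ 48 * N + S → 6 * c ≤ 48 * N + S
    6c≤48N+ S n³≤ = ≤-trans 6c≤n³ n³≤

  2c≤16d+ : ∀ n c d S → 2 * c + n ≡ n * n → n * n ≤ 16 * d + S → 2 * c ≤ 16 * d + S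
  2c≤16d+ n c d S binomial n²≤ = ≤-trans (subst (2 * c ≤_) binomial (m≤m+n (2 * c) n)) n²≤

module RationalBounds where

  open import Data.Nat as ℕ using (ℕ; zero; suc)
  import Data.Nat.Properties as ℕP
  open import Data.Integer as ℤ using (ℤ; +_; -[1+_])
  import Data.Integer.Properties as ℤP
  open import Data.Integer.Tactic.RingSolver using (solve-∀)
  open import Data.Rational as ℚ using (ℚ; mkℚ; _/_; _≤_; _<_; 0ℚ; 1ℚ; _+_; _*_; _-_; -_; ∣_∣)
  import Data.Rational.Properties as ℚP
  import Data.Rational.Unnormalised as ℚᵘ
  import Data.Rational.Unnormalised.Properties as ℚᵘP
  open import Data.Rational.Solver
  open import Data.Nat.Coprimality using (Coprime; 1-coprimeTo; sym)
  open import Data.Product using (Σ; _×_; _,_)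
  open import Data.Sum using (inj₁; inj₂)
  open import Data.Empty using (⊥-elim)
  open import Relation.Binary.PropositionalEquality hiding (sym)
  import Relation.Binary.PropositionalEquality as Eq
  open import Defs using (ℕ→ℚ)

  coprime-1 : ∀ k → Coprime k 1
  coprime-1 k = sym (1-coprimeTo k)

  ℕ→ℚ≡mkℚ : ∀ k → ℕ→ℚ k ≡ mkℚ (+ k) 0 (coprime-1 k)
  ℕ→ℚ≡mkℚ k = ℚP.normalize-coprime (coprime-1 k)

  toℚᵘ-ℕ→ℚ : ∀ k → ℚ.toℚᵘ (ℕ→ℚ k) ≡ ℚᵘ.mkℚᵘ (+ k) 0
  toℚᵘ-ℕ→ℚ k = cong ℚ.toℚᵘ (ℕ→ℚ≡mkℚ k)

  ℕ→ℚ-+ : ∀ a b → ℕ→ℚ (a ℕ.+ b) ≡ ℕ→ℚ a + ℕ→ℚ b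
  ℕ→ℚ-+ a b = ℚP.toℚᵘ-injective (ℚᵘP.≃-trans homo (ℚᵘP.≃-sym (ℚP.toℚᵘ-homo-+ (ℕ→ℚ a) (ℕ→ℚ b))))
    where
    over1 : ∀ x y → (x ℤ.+ y) ℤ.* ℤ.+ 1 ≡ (x ℤ.* ℤ.+ 1 ℤ.+ y ℤ.* ℤ.+ 1) ℤ.* ℤ.+ 1
    over1 = solve-∀
    homo : ℚ.toℚᵘ (ℕ→ℚ (a ℕ.+ b)) ℚᵘ.≃ (ℚ.toℚᵘ (ℕ→ℚ a) ℚᵘ.+ ℚ.toℚᵘ (ℕ→ℚ b))
    homo rewrite toℚᵘ-ℕ→ℚ (a ℕ.+ b) | toℚᵘ-ℕ→ℚ a | toℚᵘ-ℕ→ℚ b = ℚᵘ.*≡* (trans (cong (ℤ._* ℤ.+ 1) (ℤP.pos-+ a b)) (over1 (+ a) (+ b)))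

  ℕ→ℚ-* : ∀ a b → ℕ→ℚ (a ℕ.* b) ≡ ℕ→ℚ a * ℕ→ℚ b
  ℕ→ℚ-* a b = ℚP.toℚᵘ-injective (ℚᵘP.≃-trans homo (ℚᵘP.≃-sym (ℚP.toℚᵘ-homo-* (ℕ→ℚ a) (ℕ→ℚ b))))
    where
    homo : ℚ.toℚᵘ (ℕ→ℚ (a ℕ.* b)) ℚᵘ.≃ (ℚ.toℚᵘ (ℕ→ℚ a) ℚᵘ.* ℚ.toℚᵘ (ℕ→ℚ b))
    homo rewrite toℚᵘ-ℕ→ℚ (a ℕ.* b) | toℚᵘ-ℕ→ℚ a | toℚᵘ-ℕ→ℚ b = ℚᵘ.*≡* (cong (ℤ._* ℤ.+ 1) (ℤP.pos-* a b))

  ℕ→ℚ-mono-≤ : ∀ {a b} → a ℕ.≤ b → ℕ→ℚ a ≤ ℕ→ℚ b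
  ℕ→ℚ-mono-≤ {a} {b} a≤b rewrite ℕ→ℚ≡mkℚ a | ℕ→ℚ≡mkℚ b = ℚ.*≤* (ℤP.*-monoʳ-≤-nonNeg (ℤ.+ 1) (ℤ.+≤+ a≤b))

  open +-*-Solver

  ℕ→ℚ-nonNeg : ∀ k → ℚ.NonNegative (ℕ→ℚ k)
  ℕ→ℚ-nonNeg k = ℚ.nonNegative (ℕ→ℚ-mono-≤ {0} {k} ℕ.z≤n)

  -- For μ = a/(d+1) with a ≥ 1, take M = d + 1.
  archimedean : ∀ μ → 0ℚ < μ → Σ ℕ (λ M → (1 ℕ.≤ M) × (1ℚ ≤ μ * ℕ→ℚ M))
  archimedean (mkℚ (+ zero) d c) (ℚ.*<* 0<0) = ⊥-elim (ℤP.<-irrefl refl 0<0)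
  archimedean (mkℚ -[1+ a ] d c) (ℚ.*<* 0<μ) = ⊥-elim (ℤP.<-asym 0<μ ℤ.-<+)
  archimedean μ@(mkℚ (+ suc a) d c) _ = suc d , ℕ.s≤s ℕ.z≤n , ℚP.toℚᵘ-cancel-≤ (ℚᵘP.≤-respʳ-≃ (ℚᵘP.≃-sym (ℚP.toℚᵘ-homo-* μ (ℕ→ℚ (suc d)))) 1≤μM)
    where
    1≤μM : ℚ.toℚᵘ 1ℚ ℚᵘ.≤ (ℚᵘ.mkℚᵘ (+ suc a) d ℚᵘ.* ℚ.toℚᵘ (ℕ→ℚ (suc d)))
    1≤μM rewrite toℚᵘ-ℕ→ℚ (suc d) = ℚᵘ.*≤* (ℤ.+≤+ (ℕ.s≤s (ℕP.≤-trans (ℕP.≤-reflexive (trans (ℕP.+-identityʳ (d ℕ.* 1)) (ℕP.*-identityʳ d)))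
       (ℕP.≤-trans (ℕP.m≤m+n d (a ℕ.* suc d)) (ℕP.≤-reflexive (Eq.sym (ℕP.*-identityʳ _)))))))

  module Absorb (μ : ℚ) {{μnn : ℚ.NonNegative μ}} (M : ℕ) (1≤μM : 1ℚ ≤ μ * ℕ→ℚ M) where
    open ℚP.≤-Reasoning

    -- An error term K with M·K ≤ c·Z costs at most μ·Z after dividing by c.
    absorb : ∀ (ic : ℚ) {{_ : ℚ.NonNegative ic}} (c : ℕ) → ic * ℕ→ℚ c ≡ 1ℚ → ∀ X Y K Z →
      X ℕ.≤ Y ℕ.+ K → M ℕ.* K ℕ.≤ c ℕ.* Z → ic * ℕ→ℚ X ≤ ic * ℕ→ℚ Y + μ * ℕ→ℚ Z
    absorb ic c ic*c≡1 X Y K Z X≤Y+K MK≤cZ = begin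
        ic * ℕ→ℚ X
      ≤⟨ ℚP.*-monoˡ-≤-nonNeg ic (ℕ→ℚ-mono-≤ X≤Y+K) ⟩
        ic * ℕ→ℚ (Y ℕ.+ K)
      ≡⟨ trans (cong (ic *_) (ℕ→ℚ-+ Y K)) (ℚP.*-distribˡ-+ ic (ℕ→ℚ Y) (ℕ→ℚ K)) ⟩
        ic * ℕ→ℚ Y + ic * ℕ→ℚ K
      ≤⟨ ℚP.+-monoʳ-≤ (ic * ℕ→ℚ Y) (ℚP.*-monoˡ-≤-nonNeg ic K≤μcZ) ⟩
        ic * ℕ→ℚ Y + ic * (μ * (ℕ→ℚ c * ℕ→ℚ Z))
      ≡⟨ cong (_+_ (ic * ℕ→ℚ Y)) (trans (regroup ic μ (ℕ→ℚ c) (ℕ→ℚ Z)) (trans (cong (λ t → μ * t * ℕ→ℚ Z) ic*c≡1) (drop-1 μ (ℕ→ℚ Z)))) ⟩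
        ic * ℕ→ℚ Y + μ * ℕ→ℚ Z ∎
      where
      regroup : ∀ a b c z → a * (b * (c * z)) ≡ b * (a * c) * z
      regroup = solve 4 (λ a b c z → a :* (b :* (c :* z)) := b :* (a :* c) :* z) refl
      drop-1 : ∀ b z → b * 1ℚ * z ≡ b * z
      drop-1 = solve 2 (λ b z → b :* con 1ℚ :* z := b :* z) refl
      rotate : ∀ k m u → k * (u * m) ≡ u * (m * k)
      rotate = solve 3 (λ k m u → k :* (u :* m) := u :* (m :* k)) refl
      K≤μcZ : ℕ→ℚ K ≤ μ * (ℕ→ℚ c * ℕ→ℚ Z)
      K≤μcZ = begin
          ℕ→ℚ K
        ≡⟨ Eq.sym (ℚP.*-identityʳ (ℕ→ℚ K)) ⟩
          ℕ→ℚ K * 1ℚ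
        ≤⟨ ℚP.*-monoˡ-≤-nonNeg (ℕ→ℚ K) {{ℕ→ℚ-nonNeg K}} 1≤μM ⟩
          ℕ→ℚ K * (μ * ℕ→ℚ M)
        ≡⟨ trans (rotate (ℕ→ℚ K) (ℕ→ℚ M) μ) (cong (μ *_) (Eq.sym (ℕ→ℚ-* M K))) ⟩
          μ * ℕ→ℚ (M ℕ.* K)
        ≤⟨ ℚP.*-monoˡ-≤-nonNeg μ (ℕ→ℚ-mono-≤ MK≤cZ) ⟩
          μ * ℕ→ℚ (c ℕ.* Z)
        ≡⟨ cong (μ *_) (ℕ→ℚ-* c Z) ⟩
          μ * (ℕ→ℚ c * ℕ→ℚ Z) ∎

    ⅛ : ℚ
    ⅛ = + 1 / 8

    private
      ≤+⇒-≤ : ∀ {p q s} → p ≤ s + q → p - q ≤ s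
      ≤+⇒-≤ {p} {q} {s} p≤s+q = ℚP.≤-trans (ℚP.+-monoˡ-≤ (- q) p≤s+q) (ℚP.≤-reflexive (cancel s q))
        where
        cancel : ∀ s q → s + q - q ≡ s
        cancel = solve 2 (λ s q → s :+ q :- q := s) refl

      scale : ∀ (ic r : ℚ) c X → ic * ℕ→ℚ c ≡ r → ic * ℕ→ℚ (c ℕ.* X) ≡ r * ℕ→ℚ X
      scale ic r c X ic*c≡r = trans (cong (ic *_) (ℕ→ℚ-* c X)) (trans (Eq.sym (ℚP.*-assoc ic (ℕ→ℚ c) (ℕ→ℚ X))) (cong (_* ℕ→ℚ X) ic*c≡r))

      cancelˡ : ∀ (ic : ℚ) c X → ic * ℕ→ℚ c ≡ 1ℚ → ic * ℕ→ℚ (c ℕ.* X) ≡ ℕ→ℚ X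
      cancelˡ ic c X ic*c≡1 = trans (scale ic 1ℚ c X ic*c≡1) (ℚP.*-identityˡ (ℕ→ℚ X))

      ⅟₄₈ : ℚ
      ⅟₄₈ = + 1 / 48

      N≤ : ∀ N C K Z → 48 ℕ.* N ℕ.≤ 6 ℕ.* C ℕ.+ K → M ℕ.* K ℕ.≤ 48 ℕ.* Z → ℕ→ℚ N ≤ μ * ℕ→ℚ Z + ⅛ * ℕ→ℚ C
      N≤ N C K Z 48N≤6C+K MK≤48Z = subst₂ _≤_ (cancelˡ ⅟₄₈ 48 N refl)
        (trans (cong (_+ μ * ℕ→ℚ Z) (scale ⅟₄₈ ⅛ 6 C refl)) (ℚP.+-comm (⅛ * ℕ→ℚ C) (μ * ℕ→ℚ Z)))
        (absorb ⅟₄₈ 48 refl (48 ℕ.* N) (6 ℕ.* C) K Z 48N≤6C+K MK≤48Z)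

      ⅛C≤ : ∀ N C K Z → 6 ℕ.* C ℕ.≤ 48 ℕ.* N ℕ.+ K → M ℕ.* K ℕ.≤ 48 ℕ.* Z → ⅛ * ℕ→ℚ C ≤ μ * ℕ→ℚ Z + ℕ→ℚ N
      ⅛C≤ N C K Z 6C≤48N+K MK≤48Z = subst₂ _≤_ (scale ⅟₄₈ ⅛ 6 C refl)
        (trans (cong (_+ μ * ℕ→ℚ Z) (cancelˡ ⅟₄₈ 48 N refl)) (ℚP.+-comm (ℕ→ℚ N) (μ * ℕ→ℚ Z)))
        (absorb ⅟₄₈ 48 refl (6 ℕ.* C) (48 ℕ.* N) K Z 6C≤48N+K MK≤48Z)

    density≥ : ∀ A e N³ K → A ℕ.≤ 8 ℕ.* e ℕ.+ K → M ℕ.* K ℕ.≤ 8 ℕ.* N³ → ⅛ * ℕ→ℚ A - μ * ℕ→ℚ N³ ≤ ℕ→ℚ e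
    density≥ A e N³ K A≤8e+K MK≤8N³ =
      ≤+⇒-≤ (subst (λ t → ⅛ * ℕ→ℚ A ≤ t + μ * ℕ→ℚ N³) (cancelˡ ⅛ 8 e refl) (absorb ⅛ 8 refl A (8 ℕ.* e) K N³ A≤8e+K MK≤8N³))

    edgeCount≈ : ∀ N C Z K → 48 ℕ.* N ℕ.≤ 6 ℕ.* C ℕ.+ K → 6 ℕ.* C ℕ.≤ 48 ℕ.* N ℕ.+ K → M ℕ.* K ℕ.≤ 48 ℕ.* Z →
      ∣ ℕ→ℚ N - ⅛ * ℕ→ℚ C ∣ ≤ μ * ℕ→ℚ Z
    edgeCount≈ N C Z K 48N≤ 6C≤ MK≤48Z with ℚP.∣p∣≡p∨∣p∣≡-p (ℕ→ℚ N - ⅛ * ℕ→ℚ C)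
    ... | inj₁ ∣d∣≡d  rewrite ∣d∣≡d  = ≤+⇒-≤ (N≤ N C K Z 48N≤ MK≤48Z)
    ... | inj₂ ∣d∣≡-d rewrite ∣d∣≡-d = ℚP.≤-trans (ℚP.≤-reflexive (negate (ℕ→ℚ N) (⅛ * ℕ→ℚ C))) (≤+⇒-≤ (⅛C≤ N C K Z 6C≤ MK≤48Z))
      where
      negate : ∀ a b → - (a - b) ≡ b - a
      negate = solve 2 (λ a b → :- (a :- b) := b :- a) refl

    degree≥ : ∀ C d K → 2 ℕ.* C ℕ.≤ 16 ℕ.* d ℕ.+ K → M ℕ.* K ℕ.≤ 16 ℕ.* C → (⅛ - μ) * ℕ→ℚ C ≤ ℕ→ℚ d
    degree≥ C d K 2C≤16d+K MK≤16C = ℚP.≤-trans (ℚP.≤-reflexive (distrib ⅛ μ (ℕ→ℚ C)))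
      (≤+⇒-≤ (subst₂ (λ a b → a ≤ b + μ * ℕ→ℚ C) (scale (+ 1 / 16) ⅛ 2 C refl) (cancelˡ (+ 1 / 16) 16 d refl)
                     (absorb (+ 1 / 16) 16 refl (2 ℕ.* C) (16 ℕ.* d) K C 2C≤16d+K MK≤16C)))
      where
      distrib : ∀ r u c → (r - u) * c ≡ r * c - u * c
      distrib = solve 3 (λ r u c → (r :- u) :* c := r :* c :- u :* c) refl

open import Defs
open import Data.Nat using (ℕ; _≥_; _*_)
open import Data.Nat.Combinatorics using (_C_)
open import Data.Nat.Divisibility using (_∣_)
open import Data.Integer using (+_)
open import Data.Rational using (ℚ; _/_; _≤_; _<_; _-_; ∣_∣; 0ℚ) renaming (_*_ to _*ℚ_)
open import Data.Product using (Σ; _×_)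
open import Relation.Nullary using (¬_)

open import Data.Nat as ℕ using (suc; _+_; NonZero)
import Data.Nat.Properties as ℕP
open import Data.Nat.DivMod using (_%_; m≡m%n+[m/n]*n; m≥n⇒m/n>0; m%n<n) renaming (_/_ to _/ℕ_)
open import Data.Fin using (Fin; _↑ˡ_)
import Data.Rational as ℚ
import Data.Rational.Properties as ℚP
open import Data.Product using (_,_)
open import Relation.Binary.PropositionalEquality
open Sylvester using (size; size-suc; size-+; origin; k<size)
open BlowUp
open Construction
open NatArithmetic
open RationalBounds

Counterexample : ∀ {m} (F : Graph3 m) (μ : ℚ) {n} → Graph3 n → Set
Counterexample F μ {n} H =
  (∣ ℕ→ℚ (numEdges H) - ((+ 1 / 8) *ℚ ℕ→ℚ (n C 3)) ∣ ≤ μ *ℚ ℕ→ℚ (n * n * n)) ×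
  Dense (+ 1 / 8) μ H ×
  (∀ v → ((+ 1 / 8) - μ) *ℚ ℕ→ℚ (n C 2) ≤ ℕ→ℚ (degree H v)) ×
  ¬ PerfectPacking F H

module _ {m} (F : Graph3 m) (pair : PairCondition F) (μ : ℚ) {{_ : ℚ.NonNegative μ}}
         (M : ℕ) (1≤M : 1 ℕ.≤ M) (1≤μM : ℚ.1ℚ ≤ μ *ℚ ℕ→ℚ M) (j q′ rr : ℕ) where
  open BlownUpSylvester j q′ rr
  open Absorb μ M 1≤μM

  counterexample : 3 * M ℕ.≤ R → 2 * D * R + 4 * R ℕ.≤ n → rr ℕ.≤ D → Σ (Graph3 n) (Counterexample F μ)
  counterexample 3M≤R n-large rr≤D = H , edgeCount , dense , minDegree , noPerfectPacking F pair
    where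
    special : Fin n
    special = (origin k ↑ˡ (q′ * D)) ↑ˡ rr
    open Hypergraph n special adj adj-sym
    open Estimates discrepancy bilinearDiscrepancy rr rowSum≥

    instance
      R≢0 : NonZero R
      R≢0 = subst NonZero (sym (size-suc j)) _

    RE≤ : R * discrepancy ℕ.≤ 4 * (n * n) + 8 * (D * R * n)
    RE≤ = R*discrepancy≤ q R D rr n (size-+ j j) (ℕP.m≤m+n (q * D) rr) rr≤D

    M*slack≤8n³ : M * slack ℕ.≤ 8 * (n * n * n)
    M*slack≤8n³ = M*slack≤ M R D n discrepancy RE≤ 3M≤R n-large

    edgeCount : ∣ ℕ→ℚ (numEdges H) - ((+ 1 / 8) *ℚ ℕ→ℚ (n C 3)) ∣ ≤ μ *ℚ ℕ→ℚ (n * n * n)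
    edgeCount = edgeCount≈ (numEdges H) (n C 3) (n * n * n) slack
      (48N≤6c+ n (numEdges H) (n C 3) (binomial₃ n) K edgesUpper′)
      (6c≤48N+ n (numEdges H) (n C 3) (binomial₃ n) slack edgesLower′)
      (ℕP.≤-trans M*slack≤8n³ (ℕP.*-monoˡ-≤ (n * n * n) (ℕP.m≤m+n 8 40)))

    dense : Dense (+ 1 / 8) μ H
    dense X₁ X₂ X₃ = density≥ _ (e H X₁ X₂ X₃) (n ℕ.^ 3) slack (density′ X₁ X₂ X₃)
      (subst (λ n³ → M * slack ℕ.≤ 8 * n³) (sym n^3≡) M*slack≤8n³)
      where
      n^3≡ : n ℕ.^ 3 ≡ n * n * n
      n^3≡ = trans (cong (λ t → n * (n * t)) (ℕP.*-identityʳ n)) (sym (ℕP.*-assoc n n n))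

    minDegree : ∀ v → ((+ 1 / 8) - μ) *ℚ ℕ→ℚ (n C 2) ≤ ℕ→ℚ (degree H v)
    minDegree v = degree≥ (n C 2) (degree H v) degreeSlack
      (2c≤16d+ n (n C 2) (degree H v) degreeSlack (binomial₂ n) (degree′ (ℕP.m≤n+m rr (q * D)) v))
      (M*degreeSlack≤ M R D n discrepancy RE≤ 3M≤R n-large rr (n C 2) 1≤M rr≤D (binomial₂ n))

blockDecomposition : ∀ n D .{{_ : NonZero D}} → D ℕ.≤ n → Σ ℕ λ q′ → Σ ℕ λ rr → (suc q′ * D + rr ≡ n) × rr ℕ.≤ D
blockDecomposition n D D≤n with n /ℕ D | m≡m%n+[m/n]*n n D | m≥n⇒m/n>0 {n} {D} D≤n
... | suc q′ | n≡rr+qD | _ = q′ , n % D , trans (ℕP.+-comm (suc q′ * D) (n % D)) (sym n≡rr+qD) , ℕP.<⇒≤ (m%n<n n D)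

theorem1p6 : ∀ {m : ℕ} (F : Graph3 m) → 2 ∣ m → PairCondition F →
    ∀ (μ : ℚ) → 0ℚ < μ →
    Σ ℕ λ n₀ → ∀ (n : ℕ) → n ≥ n₀ →
    Σ (Graph3 n) λ H →
    (∣ ℕ→ℚ (numEdges H) - ((+ 1 / 8) *ℚ ℕ→ℚ (n C 3)) ∣ ≤ μ *ℚ ℕ→ℚ (n * n * n)) ×
    Dense (+ 1 / 8) μ H ×
    (∀ v → ((+ 1 / 8) - μ) *ℚ ℕ→ℚ (n C 2) ≤ ℕ→ℚ (degree H v)) ×
    ¬ PerfectPacking F H
theorem1p6 F _ pair μ 0<μ with archimedean μ 0<μ
... | M , 1≤M , 1≤μM = 2 * D * R + 4 * R + D , construct
  where
  instance
    μ≥0 : ℚ.NonNegative μ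
    μ≥0 = ℚP.pos⇒nonNeg μ {{ℚ.positive 0<μ}}
  j = 3 * M
  R = size j
  D = size (j + j)
  instance
    D≢0 : NonZero D
    D≢0 = subst NonZero (sym (size-suc (j + j))) _
  construct : ∀ n → n ≥ 2 * D * R + 4 * R + D → Σ (Graph3 n) (Counterexample F μ)
  construct n n≥n₀ with blockDecomposition n D (ℕP.≤-trans (ℕP.m≤n+m D _) n≥n₀)
  ... | q′ , rr , refl , rr≤D = counterexample F pair μ M 1≤M 1≤μM j q′ rr (ℕP.<⇒≤ (k<size j))
                                  (ℕP.≤-trans (ℕP.m≤m+n _ D) n≥n₀) rr≤D
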